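{- Let $c\ge 3$, $b\ge 1$ be integers. Then $\lambda(\mathcal T_{c,b})=c+1$ if $b=1$, and $\lambda(\mathcal T_{c,b})=c$ if $b\ge 2$.
   Context: $G_{c,b}$ is the graph on vertex set $\{1,\dots,b+c\}$ with edges $\{i,j\}$ for $1\le i<j\le c$ and $\{i,j\}$ for $c+1\le i\le c+b$, $1\le j\le c$; $\mathcal T_{c,b}$ is the set of all triangles ($3$-cliques) of $G_{c,b}$. For $T=\{p,q,r\}$ with $p<q<r$ and a $2$-element subset $e$, $[T:e]$ is $1$ if $e=\{p,q\}$ or $\{q,r\}$, $-1$ if $e=\{p,r\}$, $0$ if $e\not\subset T$. For a family $\mathcal T$ of triangles, $\delta_{1,\mathcal T}$ is the $\mathcal T\times E$ matrix with entries $[T:e]$ (edges of the support graph), and $\lambda(\mathcal T)$ is the smallest positive eigenvalue of $\delta_{1,\mathcal T}^T\delta_{1,\mathcal T}$. -}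

module Defs where

open import Level using (Level; _⊔_) renaming (suc to lsuc)
open import Data.Nat using (ℕ; zero; suc; _<ᵇ_; _≤ᵇ_; _≡ᵇ_)
open import Data.Nat using () renaming (_+_ to _+ℕ_)
open import Data.Bool using (Bool; true; false; _∧_; _∨_; if_then_else_)
open import Data.Product using (_×_; _,_; ∃; Σ)
open import Data.List using (List; []; _∷_; concatMap; filter; foldr; upTo; map; length)
open import Data.List.Membership.Propositional using (_∈_)
open import Data.Bool.ListAction using (any)
open import Relation.Nullary using (¬_)
open import Relation.Binary using (Rel; IsStrictTotalOrder)
open import Algebra.Bundles using (CommutativeRing)

record OrderedField (c ℓ : Level) : Set (lsuc (c ⊔ ℓ)) where
  field
    commRing : CommutativeRing c ℓ
  open CommutativeRing commRing public
  field
    _<_        : Rel Carrier ℓ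
    isSTO      : IsStrictTotalOrder _≈_ _<_
    0<1        : 0# < 1#
    +-mono-<   : ∀ {x y} z → x < y → (x + z) < (y + z)
    *-pos      : ∀ {x y} → 0# < x → 0# < y → 0# < (x * y)
    inverse    : ∀ x → ¬ (x ≈ 0#) → Σ Carrier (λ y → (x * y) ≈ 1#)

-- Vertices are 1 … n (natural numbers).  An edge {i,j} is stored as the
-- pair (i , j) with i < j; a triangle {p,q,r} as (p , q , r) with p<q<r.

Edge : Set
Edge = ℕ × ℕ

Triangle : Set
Triangle = ℕ × ℕ × ℕ

verts : ℕ → List ℕ
verts n = map suc (upTo n)

-- adjacency in G_{c,b}, for vertices 1 ≤ i < j ≤ c + b
adjG : ℕ → ℕ → ℕ → ℕ → Bool
adjG c b i j = (j ≤ᵇ c) ∨ ((i ≤ᵇ c) ∧ ((c <ᵇ j) ∧ (j ≤ᵇ c +ℕ b)))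

triangles : ℕ → ℕ → List Triangle
triangles c b =
  concatMap (λ p → concatMap (λ q → concatMap (λ r →
      if (p <ᵇ q) ∧ (q <ᵇ r) ∧ adjG c b p q ∧ adjG c b q r ∧ adjG c b p r
      then (p , q , r) ∷ [] else [])
    (verts (c +ℕ b))) (verts (c +ℕ b))) (verts (c +ℕ b))

eqE : Edge → Edge → Bool
eqE (i , j) (k , l) = (i ≡ᵇ k) ∧ (j ≡ᵇ l)

edgeIn : Edge → Triangle → Bool
edgeIn e (p , q , r) = eqE e (p , q) ∨ eqE e (q , r) ∨ eqE e (p , r)

supportEdges : ℕ → List Triangle → List Edge
supportEdges n Ts =
  concatMap (λ i → concatMap (λ j →
      if (i <ᵇ j) ∧ any (edgeIn (i , j)) Ts then (i , j) ∷ [] else [])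
    (verts n)) (verts n)

module _ {c ℓ} (F : OrderedField c ℓ) where
  open OrderedField F

  inc : Triangle → Edge → Carrier
  inc (p , q , r) e =
    if eqE e (p , q) ∨ eqE e (q , r) then 1#
    else if eqE e (p , r) then - 1# else 0#

  sumL : ∀ {A : Set} → List A → (A → Carrier) → Carrier
  sumL xs f = foldr (λ x acc → f x + acc) 0# xs

  fromℕ : ℕ → Carrier
  fromℕ zero    = 0#
  fromℕ (suc n) = 1# + fromℕ n

  -- (δ₁ᵀ δ₁ v)(e) for the 𝒯 × E matrix δ₁ with entries [T : e]
  lap : List Triangle → List Edge → (Edge → Carrier) → Edge → Carrier
  lap Ts Es v e = sumL Ts (λ T → inc T e * sumL Es (λ f → inc T f * v f))

  IsEigenvalue : ℕ → List Triangle → Carrier → Set (c ⊔ ℓ)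
  IsEigenvalue n Ts μ =
    let Es = supportEdges n Ts in
    Σ (Edge → Carrier) λ v →
      (Σ Edge λ e → (e ∈ Es) × ¬ (v e ≈ 0#)) ×
      (∀ e → e ∈ Es → lap Ts Es v e ≈ (μ * v e))

  IsSmallestPosEigenvalue : ℕ → List Triangle → Carrier → Set (c ⊔ ℓ)
  IsSmallestPosEigenvalue n Ts λ₀ =
    (0# < λ₀) × IsEigenvalue n Ts λ₀ ×
    (∀ μ → 0# < μ → IsEigenvalue n Ts μ → ¬ (μ < λ₀))

{-# OPTIONS --safe #-}
module Submission where

-- Extend an edge function v antisymmetrically to W on ordered pairs of vertices.  For c ≥ 3
-- every edge of G_{c,b} lies in a triangle, so the support edges are the clique edges {a,d}
-- (a < d ≤ c) and the cross edges {a,x} (a ≤ c < x), and on them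
--   (δᵀδ v)(a,d) = (c+b) W(a,d) + ρ(d) - ρ(a),   (δᵀδ v)(a,x) = c W(a,x) + σ(x) - σ(a),
-- where ρ and σ are the row sums of W over all vertices and over the clique.  For an
-- eigenvector with eigenvalue μ, summing these equations along the row of a clique vertex a
-- gives μ ρ(a) = 0.  Hence if μ ∉ {0, c+b} then ρ = 0 and v vanishes on the clique edges;
-- it then vanishes on the cross edges as well, when b = 1 because W(a,c+1) = ρ(a) - σ(a),
-- and when μ ≠ c by summing the cross equations over a.  Conversely, the wedge P ∧ Q of
-- P = e₁ - e₃, Q = e₂ - e₃ (resp. P = e₁ - e₂, Q = e_{c+1} - e_{c+2}, when b ≥ 2) has
-- vanishing row sums and is an eigenvector with eigenvalue c + b (resp. c).

open import Defs
open import Algebra.Bundles using (CommutativeRing)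
open import Data.Nat using (ℕ; _≤_)

module BooleanComparisons where
  open import Data.Nat using (_≤_; _<_; _<ᵇ_; _≤ᵇ_; _≡ᵇ_; _≟_; _<?_; _≤?_)
  open import Data.Nat.Properties using (≤⇒≯; <⇒≱)
  open import Data.Bool using (true; false)
  open import Relation.Nullary.Decidable using (dec-true; dec-false)
  open import Relation.Binary.PropositionalEquality using (_≡_; _≢_; refl)

  <ᵇ-true : ∀ {m n} → m < n → (m <ᵇ n) ≡ true
  <ᵇ-true {m} {n} = dec-true (m <? n)

  <ᵇ-false : ∀ {m n} → n ≤ m → (m <ᵇ n) ≡ false
  <ᵇ-false {m} {n} n≤m = dec-false (m <? n) (≤⇒≯ n≤m)

  ≤ᵇ-true : ∀ {m n} → m ≤ n → (m ≤ᵇ n) ≡ true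
  ≤ᵇ-true {m} {n} = dec-true (m ≤? n)

  ≤ᵇ-false : ∀ {m n} → n < m → (m ≤ᵇ n) ≡ false
  ≤ᵇ-false {m} {n} n<m = dec-false (m ≤? n) (<⇒≱ n<m)

  ≡ᵇ-refl : ∀ n → (n ≡ᵇ n) ≡ true
  ≡ᵇ-refl n = dec-true (n ≟ n) refl

  ≢⇒≡ᵇ-false : ∀ {m n} → m ≢ n → (m ≡ᵇ n) ≡ false
  ≢⇒≡ᵇ-false {m} {n} = dec-false (m ≟ n)

module VertexLists where
  open import Data.Nat using (ℕ; suc; _≤_; z≤n; s≤s)
  open import Data.Bool using (true; T; if_then_else_)
  open import Data.List using (List; []; _∷_; concatMap)
  open import Data.List.Relation.Unary.Any using (here)
  open import Data.List.Membership.Propositional using (_∈_; lose; find)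
  open import Data.List.Membership.Propositional.Properties
    using (∈-concatMap⁺; ∈-concatMap⁻; ∈-map⁺; ∈-map⁻; ∈-upTo⁺; ∈-upTo⁻)
  open import Data.Product using (_×_; _,_; ∃-syntax)
  open import Relation.Binary.PropositionalEquality using (_≡_; refl)

  ∈-verts⁺ : ∀ {n i} → 1 ≤ i → i ≤ n → i ∈ verts n
  ∈-verts⁺ {i = suc i} _ i<n = ∈-map⁺ suc (∈-upTo⁺ i<n)

  ∈-verts⁻ : ∀ {n i} → i ∈ verts n → 1 ≤ i × i ≤ n
  ∈-verts⁻ i∈ with ∈-map⁻ suc i∈
  ... | _ , j<n , refl = s≤s z≤n , ∈-upTo⁻ j<n

  module _ {A : Set} (f : ℕ → List A) (n : ℕ) {y : A} where

    ∈-concatMap-verts⁺ : ∀ {i} → 1 ≤ i → i ≤ n → y ∈ f i → y ∈ concatMap f (verts n)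
    ∈-concatMap-verts⁺ 1≤i i≤n y∈ = ∈-concatMap⁺ f (lose (∈-verts⁺ 1≤i i≤n) y∈)

    ∈-concatMap-verts⁻ : y ∈ concatMap f (verts n) → ∃[ i ] 1 ≤ i × i ≤ n × y ∈ f i
    ∈-concatMap-verts⁻ y∈ with find (∈-concatMap⁻ f {xs = verts n} y∈)
    ... | i , i∈ , y∈fi with ∈-verts⁻ i∈
    ...   | 1≤i , i≤n = i , 1≤i , i≤n , y∈fi

  module _ {A : Set} {x : A} where

    ∈-if-singleton⁺ : ∀ b → T b → x ∈ (if b then x ∷ [] else [])
    ∈-if-singleton⁺ true _ = here refl

    ∈-if-singleton⁻ : ∀ {y} b → y ∈ (if b then x ∷ [] else []) → T b × y ≡ x
    ∈-if-singleton⁻ true (here y≡x) = _ , y≡x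

-- Every commutative ring is a ℤ-algebra.  The ring solver needs a coefficient ring in which
-- it can recognise vanishing coefficients, so ℤ is used rather than the ring itself.
module IntegerCoefficientSolver {c ℓ} (R : CommutativeRing c ℓ) where
  open import Data.Nat as ℕ using (zero; suc)
  open import Data.Nat.Properties using (+-suc)
  open import Data.Integer as ℤ using (ℤ; +_; -[1+_]; _⊖_)
  open import Data.Integer.Properties using ([1+m]⊖[1+n]≡m⊖n)
  open import Data.Sign using () renaming (+ to ⁺; - to ⁻)
  open import Data.Maybe using (Maybe; just; nothing)
  open import Relation.Nullary using (yes; no)
  open import Relation.Binary.PropositionalEquality as ≡ using (_≡_)
  import Algebra.Solver.Ring.AlmostCommutativeRing as ACR
  open CommutativeRing R
  open import Algebra.Properties.Ring ring using (-0#≈0#; -‿+-comm; -‿involutive; -‿distribˡ-*; -‿distribʳ-*)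
  open import Algebra.Properties.Semiring.Mult.TCOptimised semiring using (_×_; 1+×; ×-homo-+; ×1-homo-*)
  open import Algebra.Properties.CommutativeSemigroup +-commutativeSemigroup using (interchange)
  open import Relation.Binary.Reasoning.Setoid setoid

  private
    ⟦_⟧ : ℤ → Carrier
    ⟦ + n ⟧      = n × 1#
    ⟦ -[1+ n ] ⟧ = - (suc n × 1#)

    ⟦⊖⟧ : ∀ m n → ⟦ m ⊖ n ⟧ ≈ m × 1# - n × 1#
    ⟦⊖⟧ m       zero    = sym (trans (+-congˡ -0#≈0#) (+-identityʳ _))
    ⟦⊖⟧ zero    (suc n) = sym (+-identityˡ _)
    ⟦⊖⟧ (suc m) (suc n) = begin
      ⟦ suc m ⊖ suc n ⟧               ≡⟨ ≡.cong ⟦_⟧ ([1+m]⊖[1+n]≡m⊖n m n) ⟩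
      ⟦ m ⊖ n ⟧                       ≈⟨ ⟦⊖⟧ m n ⟩
      m × 1# - n × 1#                 ≈⟨ sym (+-identityˡ _) ⟩
      0# + (m × 1# - n × 1#)          ≈⟨ +-congʳ (sym (-‿inverseʳ 1#)) ⟩
      (1# - 1#) + (m × 1# - n × 1#)   ≈⟨ interchange 1# (- 1#) (m × 1#) (- (n × 1#)) ⟩
      (1# + m × 1#) + (- 1# - n × 1#) ≈⟨ +-congˡ (-‿+-comm 1# (n × 1#)) ⟩
      (1# + m × 1#) - (1# + n × 1#)   ≈⟨ sym (+-cong (1+× m 1#) (-‿cong (1+× n 1#))) ⟩
      suc m × 1# - suc n × 1#         ∎

    ⟦⁺◃⟧ : ∀ n → ⟦ ⁺ ℤ.◃ n ⟧ ≈ n × 1#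
    ⟦⁺◃⟧ zero    = refl
    ⟦⁺◃⟧ (suc n) = refl

    ⟦⁻◃⟧ : ∀ n → ⟦ ⁻ ℤ.◃ n ⟧ ≈ - (n × 1#)
    ⟦⁻◃⟧ zero    = sym -0#≈0#
    ⟦⁻◃⟧ (suc n) = refl

    +-homo : ∀ i j → ⟦ i ℤ.+ j ⟧ ≈ ⟦ i ⟧ + ⟦ j ⟧
    +-homo (+ m)    (+ n)    = ×-homo-+ 1# m n
    +-homo (+ m)    -[1+ n ] = ⟦⊖⟧ m (suc n)
    +-homo -[1+ m ] (+ n)    = trans (⟦⊖⟧ n (suc m)) (+-comm _ _)
    +-homo -[1+ m ] -[1+ n ] = begin
      - (suc (suc (m ℕ.+ n)) × 1#)   ≡⟨ ≡.cong (λ k → - (suc k × 1#)) (≡.sym (+-suc m n)) ⟩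
      - ((suc m ℕ.+ suc n) × 1#)     ≈⟨ -‿cong (×-homo-+ 1# (suc m) (suc n)) ⟩
      - (suc m × 1# + suc n × 1#)    ≈⟨ sym (-‿+-comm _ _) ⟩
      - (suc m × 1#) - suc n × 1#    ∎

    *-homo : ∀ i j → ⟦ i ℤ.* j ⟧ ≈ ⟦ i ⟧ * ⟦ j ⟧
    *-homo (+ m)    (+ n)    = trans (⟦⁺◃⟧ (m ℕ.* n)) (×1-homo-* m n)
    *-homo (+ m)    -[1+ n ] = trans (⟦⁻◃⟧ (m ℕ.* suc n)) (trans (-‿cong (×1-homo-* m (suc n))) (-‿distribʳ-* _ _))
    *-homo -[1+ m ] (+ n)    = trans (⟦⁻◃⟧ (suc m ℕ.* n)) (trans (-‿cong (×1-homo-* (suc m) n)) (-‿distribˡ-* _ _))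
    *-homo -[1+ m ] -[1+ n ] = begin
      (suc m ℕ.* suc n) × 1#            ≈⟨ ×1-homo-* (suc m) (suc n) ⟩
      suc m × 1# * suc n × 1#           ≈⟨ sym (-‿involutive _) ⟩
      - - (suc m × 1# * suc n × 1#)     ≈⟨ -‿cong (-‿distribˡ-* _ _) ⟩
      - (- (suc m × 1#) * suc n × 1#)   ≈⟨ -‿distribʳ-* _ _ ⟩
      - (suc m × 1#) * - (suc n × 1#)   ∎

    neg-homo : ∀ i → ⟦ ℤ.- i ⟧ ≈ - ⟦ i ⟧
    neg-homo (+ zero)  = sym -0#≈0#
    neg-homo (+ suc n) = refl
    neg-homo -[1+ n ]  = sym (-‿involutive _)

    R′ : ACR.AlmostCommutativeRing c ℓ
    R′ = ACR.fromCommutativeRing R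

    ℤ-morphism : ℤ.+-*-rawRing ACR.-Raw-AlmostCommutative⟶ R′
    ℤ-morphism = record
      { ⟦_⟧ = ⟦_⟧ ; +-homo = +-homo ; *-homo = *-homo ; -‿homo = neg-homo ; 0-homo = refl ; 1-homo = refl }

    _≟ℤ_ : ∀ i j → Maybe (⟦ i ⟧ ≈ ⟦ j ⟧)
    i ≟ℤ j with i ℤ.≟ j
    ... | yes ≡.refl = just refl
    ... | no _       = nothing

  open import Algebra.Solver.Ring ℤ.+-*-rawRing R′ ℤ-morphism _≟ℤ_ public

  :0 :1 : ∀ {m} → Polynomial m
  :0 = con (+ 0)
  :1 = con (+ 1)

module FiniteSums {c ℓ} (R : CommutativeRing c ℓ) where
  open import Data.Nat as ℕ using (zero; suc; _<_; _≡ᵇ_; _≟_; z≤n; s≤s)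
  open import Data.Nat.Properties as ℕ using ()
  open import Data.Bool using (Bool; true; false; if_then_else_; _∧_)
  open import Function using (_∘_)
  open import Relation.Nullary using (yes; no)
  open import Relation.Binary.PropositionalEquality as ≡ using (_≢_)
  open BooleanComparisons using (≡ᵇ-refl; ≢⇒≡ᵇ-false)
  open CommutativeRing R
  open import Algebra.Properties.Ring ring using (-0#≈0#; -‿+-comm)
  open import Algebra.Properties.Semiring.Mult semiring using (_×_)
  open import Algebra.Properties.CommutativeSemigroup +-commutativeSemigroup using (interchange)
  open import Relation.Binary.Reasoning.Setoid setoid

  ∑ : ℕ → (ℕ → Carrier) → Carrier
  ∑ zero    f = 0#
  ∑ (suc n) f = ∑ n f + f (suc n)

  ∑-cong-on : ∀ n {f g : ℕ → Carrier} → (∀ {i} → 1 ≤ i → i ≤ n → f i ≈ g i) → ∑ n f ≈ ∑ n g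
  ∑-cong-on zero    f≈g = refl
  ∑-cong-on (suc n) f≈g = +-cong (∑-cong-on n (λ 1≤i i≤n → f≈g 1≤i (ℕ.m≤n⇒m≤1+n i≤n))) (f≈g (s≤s z≤n) ℕ.≤-refl)

  ∑-cong : ∀ n {f g : ℕ → Carrier} → (∀ i → f i ≈ g i) → ∑ n f ≈ ∑ n g
  ∑-cong n f≈g = ∑-cong-on n (λ {i} _ _ → f≈g i)

  ∑-zero : ∀ n {f : ℕ → Carrier} → (∀ {i} → 1 ≤ i → i ≤ n → f i ≈ 0#) → ∑ n f ≈ 0#
  ∑-zero zero    f≈0 = refl
  ∑-zero (suc n) f≈0 = begin
    ∑ n _ + _ ≈⟨ +-cong (∑-zero n (λ 1≤i i≤n → f≈0 1≤i (ℕ.m≤n⇒m≤1+n i≤n))) (f≈0 (s≤s z≤n) ℕ.≤-refl) ⟩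
    0# + 0#   ≈⟨ +-identityˡ 0# ⟩
    0#        ∎

  ∑-distrib-+ : ∀ n (f g : ℕ → Carrier) → ∑ n (λ i → f i + g i) ≈ ∑ n f + ∑ n g
  ∑-distrib-+ zero    f g = sym (+-identityʳ 0#)
  ∑-distrib-+ (suc n) f g = trans (+-congʳ (∑-distrib-+ n f g)) (interchange _ _ _ _)

  ∑-distrib-neg : ∀ n (f : ℕ → Carrier) → ∑ n (λ i → - f i) ≈ - ∑ n f
  ∑-distrib-neg zero    f = sym -0#≈0#
  ∑-distrib-neg (suc n) f = trans (+-congʳ (∑-distrib-neg n f)) (-‿+-comm _ _)

  ∑-distrib-+- : ∀ n (f g h : ℕ → Carrier) → ∑ n (λ i → f i + g i - h i) ≈ ∑ n f + ∑ n g - ∑ n h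
  ∑-distrib-+- n f g h =
    trans (∑-distrib-+ n (λ i → f i + g i) (λ i → - h i)) (+-cong (∑-distrib-+ n f g) (∑-distrib-neg n h))

  *-distribˡ-∑ : ∀ n x (f : ℕ → Carrier) → x * ∑ n f ≈ ∑ n (λ i → x * f i)
  *-distribˡ-∑ zero    x f = zeroʳ x
  *-distribˡ-∑ (suc n) x f = trans (distribˡ x _ _) (+-congʳ (*-distribˡ-∑ n x f))

  *-distribʳ-∑ : ∀ n x (f : ℕ → Carrier) → ∑ n f * x ≈ ∑ n (λ i → f i * x)
  *-distribʳ-∑ zero    x f = zeroˡ x
  *-distribʳ-∑ (suc n) x f = trans (distribʳ x _ _) (+-congʳ (*-distribʳ-∑ n x f))

  ∑-const : ∀ n x → ∑ n (λ _ → x) ≈ n × x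
  ∑-const zero    x = refl
  ∑-const (suc n) x = trans (+-comm _ _) (+-congˡ (∑-const n x))

  ∑-split : ∀ m n (f : ℕ → Carrier) → ∑ (m ℕ.+ n) f ≈ ∑ m f + ∑ n (λ t → f (m ℕ.+ t))
  ∑-split m zero    f rewrite ℕ.+-identityʳ m = sym (+-identityʳ _)
  ∑-split m (suc n) f rewrite ℕ.+-suc m n     = trans (+-congʳ (∑-split m n f)) (+-assoc _ _ _)

  ∑-comm : ∀ m n (f : ℕ → ℕ → Carrier) → ∑ m (λ i → ∑ n (f i)) ≈ ∑ n (λ j → ∑ m (λ i → f i j))
  ∑-comm zero    n f = sym (∑-zero n (λ _ _ → refl))
  ∑-comm (suc m) n f = trans (+-congʳ (∑-comm m n f)) (sym (∑-distrib-+ n _ (f (suc m))))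

  𝟙 : Bool → Carrier
  𝟙 b = if b then 1# else 0#

  𝟙-∧ : ∀ x y → 𝟙 (x ∧ y) ≈ 𝟙 x * 𝟙 y
  𝟙-∧ true  y = sym (*-identityˡ _)
  𝟙-∧ false y = sym (zeroˡ _)

  ∑-delta-out : ∀ n {a} (g : ℕ → Carrier) → n < a → ∑ n (λ i → 𝟙 (i ≡ᵇ a) * g i) ≈ 0#
  ∑-delta-out n {a} g n<a = ∑-zero n term≈0
    where
    term≈0 : ∀ {i} → 1 ≤ i → i ≤ n → 𝟙 (i ≡ᵇ a) * g i ≈ 0#
    term≈0 {i} _ i≤n rewrite ≢⇒≡ᵇ-false (ℕ.<⇒≢ (ℕ.≤-<-trans i≤n n<a)) = zeroˡ (g i)

  ∑-delta : ∀ n {a} (g : ℕ → Carrier) → 1 ≤ a → a ≤ n → ∑ n (λ i → 𝟙 (i ≡ᵇ a) * g i) ≈ g a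
  ∑-delta zero    g (s≤s _) ()
  ∑-delta (suc n) {a} g 1≤a a≤1+n with a ≟ suc n
  ... | yes ≡.refl rewrite ≡ᵇ-refl a =
    trans (+-cong (∑-delta-out n g ℕ.≤-refl) (*-identityˡ (g a))) (+-identityˡ (g a))
  ... | no a≢1+n rewrite ≢⇒≡ᵇ-false (a≢1+n ∘ ≡.sym) =
    trans (+-cong (∑-delta n g 1≤a (ℕ.≤-pred (ℕ.≤∧≢⇒< a≤1+n a≢1+n))) (zeroˡ _)) (+-identityʳ (g a))

  ∑∑-delta : ∀ n {p q} (f : ℕ → ℕ → Carrier) → 1 ≤ p → p ≤ n → 1 ≤ q → q ≤ n →
             ∑ n (λ i → ∑ n (λ j → 𝟙 ((i ≡ᵇ p) ∧ (j ≡ᵇ q)) * f i j)) ≈ f p q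
  ∑∑-delta n {p} {q} f 1≤p p≤n 1≤q q≤n = begin
    ∑ n (λ i → ∑ n (λ j → 𝟙 ((i ≡ᵇ p) ∧ (j ≡ᵇ q)) * f i j))
      ≈⟨ ∑-cong n (λ i → ∑-cong n (λ j → trans (*-congʳ (𝟙-∧ (i ≡ᵇ p) (j ≡ᵇ q))) (*-assoc _ _ _))) ⟩
    ∑ n (λ i → ∑ n (λ j → 𝟙 (i ≡ᵇ p) * (𝟙 (j ≡ᵇ q) * f i j)))
      ≈⟨ ∑-cong n (λ i → sym (*-distribˡ-∑ n (𝟙 (i ≡ᵇ p)) _)) ⟩
    ∑ n (λ i → 𝟙 (i ≡ᵇ p) * ∑ n (λ j → 𝟙 (j ≡ᵇ q) * f i j))
      ≈⟨ ∑-delta n _ 1≤p p≤n ⟩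
    ∑ n (λ j → 𝟙 (j ≡ᵇ q) * f p j)
      ≈⟨ ∑-delta n (f p) 1≤q q≤n ⟩
    f p q ∎

  ∑∑-distrib-+- : ∀ m n (f g h : ℕ → ℕ → Carrier) →
    ∑ m (λ i → ∑ n (λ j → f i j + g i j - h i j)) ≈ ∑ m (λ i → ∑ n (f i)) + ∑ m (λ i → ∑ n (g i)) - ∑ m (λ i → ∑ n (h i))
  ∑∑-distrib-+- m n f g h = trans (∑-cong m (λ i → ∑-distrib-+- n (f i) (g i) (h i))) (∑-distrib-+- m _ _ _)

  ∑-𝟙 : ∀ n {a} → 1 ≤ a → a ≤ n → ∑ n (λ i → 𝟙 (i ≡ᵇ a)) ≈ 1#
  ∑-𝟙 n 1≤a a≤n = trans (∑-cong n (λ i → sym (*-identityʳ _))) (∑-delta n (λ _ → 1#) 1≤a a≤n)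

  ∑-𝟙-out : ∀ n {a} → n < a → ∑ n (λ i → 𝟙 (i ≡ᵇ a)) ≈ 0#
  ∑-𝟙-out n n<a = trans (∑-cong n (λ i → sym (*-identityʳ _))) (∑-delta-out n (λ _ → 1#) n<a)

  dipole : ℕ → ℕ → ℕ → Carrier
  dipole s t i = 𝟙 (i ≡ᵇ s) - 𝟙 (i ≡ᵇ t)

  ∑-dipole≈ : ∀ n s t → ∑ n (dipole s t) ≈ ∑ n (λ i → 𝟙 (i ≡ᵇ s)) - ∑ n (λ i → 𝟙 (i ≡ᵇ t))
  ∑-dipole≈ n s t = trans (∑-distrib-+ n _ _) (+-congˡ (∑-distrib-neg n _))

  ∑-dipole : ∀ n {s t} → 1 ≤ s → s ≤ n → 1 ≤ t → t ≤ n → ∑ n (dipole s t) ≈ 0#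
  ∑-dipole n {s} {t} 1≤s s≤n 1≤t t≤n =
    trans (∑-dipole≈ n s t) (trans (+-cong (∑-𝟙 n 1≤s s≤n) (-‿cong (∑-𝟙 n 1≤t t≤n))) (-‿inverseʳ 1#))

  ∑-dipole-out : ∀ n {s t} → n < s → n < t → ∑ n (dipole s t) ≈ 0#
  ∑-dipole-out n {s} {t} n<s n<t =
    trans (∑-dipole≈ n s t) (trans (+-cong (∑-𝟙-out n n<s) (-‿cong (∑-𝟙-out n n<t))) (-‿inverseʳ 0#))

  dipole-off : ∀ s t {i} → i ≢ s → i ≢ t → dipole s t i ≈ 0#
  dipole-off s t i≢s i≢t rewrite ≢⇒≡ᵇ-false i≢s | ≢⇒≡ᵇ-false i≢t = -‿inverseʳ 0#

  dipole-at : ∀ s t → s ≢ t → dipole s t s ≈ 1#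
  dipole-at s t s≢t rewrite ≡ᵇ-refl s | ≢⇒≡ᵇ-false s≢t = trans (+-congˡ -0#≈0#) (+-identityʳ 1#)

module OrderedFieldProperties {k ℓ} (F : OrderedField k ℓ) where
  open import Data.Nat as ℕ using (zero; suc; s≤s; z≤n)
  open import Data.Nat.Properties as ℕ using ()
  open import Data.Product using (_,_)
  open import Data.Sum using (inj₁; inj₂)
  open import Function using (_∘_)
  open import Relation.Nullary using (¬_)
  open import Relation.Binary.PropositionalEquality as ≡ using ()
  open import Relation.Binary.Structures using (IsStrictTotalOrder)
  open OrderedField F
  open IntegerCoefficientSolver commRing
  open FiniteSums commRing
  open import Algebra.Properties.Semiring.Mult semiring using (_×_)
  open IsStrictTotalOrder isSTO using (irrefl; <-respˡ-≈) renaming (trans to <-trans)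
  open import Relation.Binary.Reasoning.Setoid setoid

  <⇒≉ : ∀ {x y} → x < y → ¬ x ≈ y
  <⇒≉ x<y x≈y = irrefl x≈y x<y

  fromℕ<fromℕ-suc : ∀ m → fromℕ F m < fromℕ F (suc m)
  fromℕ<fromℕ-suc m = <-respˡ-≈ (+-identityˡ _) (+-mono-< (fromℕ F m) 0<1)

  fromℕ-mono-< : ∀ {m n} → m ℕ.< n → fromℕ F m < fromℕ F n
  fromℕ-mono-< {m} {suc n} (s≤s m≤n) with ℕ.m≤n⇒m<n∨m≡n m≤n
  ... | inj₁ m<n    = <-trans (fromℕ-mono-< m<n) (fromℕ<fromℕ-suc n)
  ... | inj₂ ≡.refl = fromℕ<fromℕ-suc m

  *-cancelˡ-≉0 : ∀ {x y} → ¬ x ≈ 0# → x * y ≈ 0# → y ≈ 0#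
  *-cancelˡ-≉0 {x} {y} x≉0 xy≈0 with inverse x x≉0
  ... | x⁻¹ , xx⁻¹≈1 = begin
    y               ≈⟨ sym (*-identityˡ y) ⟩
    1# * y          ≈⟨ *-congʳ (sym xx⁻¹≈1) ⟩
    x * x⁻¹ * y     ≈⟨ solve 3 (λ x x⁻¹ y → x :* x⁻¹ :* y := x⁻¹ :* (x :* y)) refl x x⁻¹ y ⟩
    x⁻¹ * (x * y)   ≈⟨ *-congˡ xy≈0 ⟩
    x⁻¹ * 0#        ≈⟨ zeroʳ x⁻¹ ⟩
    0#              ∎

  *-cancelʳ-≉ : ∀ {l m w} → ¬ l ≈ m → l * w ≈ m * w → w ≈ 0#
  *-cancelʳ-≉ {l} {m} {w} l≉m lw≈mw = *-cancelˡ-≉0 l-m≉0 (begin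
    (l - m) * w     ≈⟨ solve 3 (λ l m w → (l :- m) :* w := l :* w :- m :* w) refl l m w ⟩
    l * w - m * w   ≈⟨ +-congʳ lw≈mw ⟩
    m * w - m * w   ≈⟨ -‿inverseʳ (m * w) ⟩
    0#              ∎)
    where
    l-m≉0 : ¬ l - m ≈ 0#
    l-m≉0 l-m≈0 = l≉m (begin
      l             ≈⟨ solve 2 (λ l m → l := (l :- m) :+ m) refl l m ⟩
      (l - m) + m   ≈⟨ +-congʳ l-m≈0 ⟩
      0# + m        ≈⟨ +-identityˡ m ⟩
      m             ∎)

  x≈-x⇒x≈0 : ∀ {x} → x ≈ - x → x ≈ 0#
  x≈-x⇒x≈0 {x} x≈-x = *-cancelˡ-≉0 (<⇒≉ (fromℕ-mono-< {0} {2} (s≤s z≤n)) ∘ sym) (begin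
    (1# + (1# + 0#)) * x  ≈⟨ solve 1 (λ x → (:1 :+ (:1 :+ :0)) :* x := x :+ x) refl x ⟩
    x + x                 ≈⟨ +-congˡ x≈-x ⟩
    x - x                 ≈⟨ -‿inverseʳ x ⟩
    0#                    ∎)

  fromℕ-+ : ∀ m n → fromℕ F (m ℕ.+ n) ≈ fromℕ F m + fromℕ F n
  fromℕ-+ zero    n = sym (+-identityˡ _)
  fromℕ-+ (suc m) n = trans (+-congˡ (fromℕ-+ m n)) (sym (+-assoc _ _ _))

  ×≈fromℕ* : ∀ m x → m × x ≈ fromℕ F m * x
  ×≈fromℕ* zero    x = sym (zeroˡ x)
  ×≈fromℕ* (suc m) x = trans (+-cong (sym (*-identityˡ x)) (×≈fromℕ* m x)) (sym (distribʳ x 1# (fromℕ F m)))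

  ∑-const-fromℕ : ∀ m x → ∑ m (λ _ → x) ≈ fromℕ F m * x
  ∑-const-fromℕ m x = trans (∑-const m x) (×≈fromℕ* m x)

  ∑∑-antisymmetric : ∀ m (f : ℕ → ℕ → Carrier) → (∀ i j → f j i ≈ - f i j) → ∑ m (λ i → ∑ m (f i)) ≈ 0#
  ∑∑-antisymmetric m f anti = x≈-x⇒x≈0 (begin
    ∑ m (λ i → ∑ m (f i))           ≈⟨ ∑-comm m m f ⟩
    ∑ m (λ j → ∑ m (λ i → f i j))   ≈⟨ ∑-cong m (λ j → ∑-cong m (λ i → anti j i)) ⟩
    ∑ m (λ j → ∑ m (λ i → - f j i)) ≈⟨ ∑-cong m (λ j → ∑-distrib-neg m (f j)) ⟩
    ∑ m (λ j → - ∑ m (f j))         ≈⟨ ∑-distrib-neg m _ ⟩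
    - ∑ m (λ i → ∑ m (f i))         ∎)

module Graph (c b : ℕ) where
  open import Data.Nat as ℕ using (zero; suc; _<_; _<ᵇ_; _≤ᵇ_; _≡ᵇ_; z≤n; s≤s)
  open import Data.Nat.Properties as ℕ using ()
  open import Data.Bool using (Bool; true; false; T; if_then_else_; _∧_; _∨_)
  open import Data.Bool.Properties as Bool using ()
  open import Data.Bool.ListAction using (any)
  open import Data.List using (List; []; _∷_; concatMap)
  open import Data.List.Relation.Unary.Any.Properties using (any⁺; any⁻)
  open import Data.List.Membership.Propositional using (_∈_; lose; find)
  open import Data.Product using (_×_; _,_; ∃-syntax)
  open import Data.Sum using (_⊎_; inj₁; inj₂)
  open import Function using (_∘_; Equivalence)
  open import Relation.Nullary using (yes; no)
  open import Relation.Binary.PropositionalEquality as ≡ using (_≡_)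
  open BooleanComparisons
  open VertexLists

  n : ℕ
  n = c ℕ.+ b

  isTriangleᵇ : ℕ → ℕ → ℕ → Bool
  isTriangleᵇ p q r = (p <ᵇ q) ∧ (q <ᵇ r) ∧ adjG c b p q ∧ adjG c b q r ∧ adjG c b p r

  adjG-≤n : ∀ {i j} → j ≤ n → adjG c b i j ≡ (j ≤ᵇ c) ∨ (i ≤ᵇ c)
  adjG-≤n {i} {j} j≤n with j ℕ.≤? c
  ... | yes j≤c rewrite ≤ᵇ-true j≤c = ≡.refl
  ... | no  j≰c rewrite ≤ᵇ-false (ℕ.≰⇒> j≰c) | <ᵇ-true (ℕ.≰⇒> j≰c) | ≤ᵇ-true j≤n = Bool.∧-identityʳ _

  isTriangleᵇ-sorted : ∀ {p q r} → p < q → q < r → r ≤ n → isTriangleᵇ p q r ≡ (q ≤ᵇ c)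
  isTriangleᵇ-sorted {p} {q} {r} p<q q<r r≤n
    rewrite <ᵇ-true p<q | <ᵇ-true q<r
          | adjG-≤n {p} {q} (ℕ.<⇒≤ (ℕ.<-≤-trans q<r r≤n)) | adjG-≤n {q} {r} r≤n | adjG-≤n {p} {r} r≤n
    with q ℕ.≤? c
  ... | yes q≤c rewrite ≤ᵇ-true q≤c | ≤ᵇ-true (ℕ.≤-trans (ℕ.<⇒≤ p<q) q≤c) | Bool.∨-zeroʳ (r ≤ᵇ c) = ≡.refl
  ... | no  q≰c rewrite ≤ᵇ-false (ℕ.≰⇒> q≰c) | ≤ᵇ-false (ℕ.<-trans (ℕ.≰⇒> q≰c) q<r) | Bool.∧-zeroʳ (p ≤ᵇ c) = ≡.refl

  isTriangleᵇ-unsorted₁ : ∀ {p q r} → q ≤ p → isTriangleᵇ p q r ≡ false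
  isTriangleᵇ-unsorted₁ q≤p rewrite <ᵇ-false q≤p = ≡.refl

  isTriangleᵇ-unsorted₂ : ∀ {p q r} → r ≤ q → isTriangleᵇ p q r ≡ false
  isTriangleᵇ-unsorted₂ {p} {q} r≤q rewrite <ᵇ-false r≤q = Bool.∧-zeroʳ (p <ᵇ q)

  isTriangleᵇ⇒sorted : ∀ {p q r} → T (isTriangleᵇ p q r) → p < q × q < r
  isTriangleᵇ⇒sorted {p} {q} {r} t with p <ᵇ q in p<ᵇq | q <ᵇ r in q<ᵇr
  ... | true | true = ℕ.<ᵇ⇒< p q (≡.subst T (≡.sym p<ᵇq) _) , ℕ.<ᵇ⇒< q r (≡.subst T (≡.sym q<ᵇr) _)

  Ts : List Triangle
  Ts = triangles c b

  triangle-or-[] : ℕ → ℕ → ℕ → List Triangle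
  triangle-or-[] p q r = if isTriangleᵇ p q r then (p , q , r) ∷ [] else []

  triangles-at : ℕ → ℕ → List Triangle
  triangles-at p q = concatMap (triangle-or-[] p q) (verts n)

  Es : List Edge
  Es = supportEdges n Ts

  ∈-triangles⁺ : ∀ {p q r} → 1 ≤ p → r ≤ n → T (isTriangleᵇ p q r) → (p , q , r) ∈ Ts
  ∈-triangles⁺ {p} {q} {r} 1≤p r≤n t with isTriangleᵇ⇒sorted {p} {q} {r} t
  ... | p<q , q<r =
    ∈-concatMap-verts⁺ (λ p → concatMap (triangles-at p) (verts n)) n 1≤p p≤n
      (∈-concatMap-verts⁺ (triangles-at p) n 1≤q q≤n
        (∈-concatMap-verts⁺ (triangle-or-[] p q) n 1≤r r≤n (∈-if-singleton⁺ (isTriangleᵇ p q r) t)))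
    where
    q≤n : q ≤ n
    q≤n = ℕ.<⇒≤ (ℕ.<-≤-trans q<r r≤n)
    p≤n : p ≤ n
    p≤n = ℕ.<⇒≤ (ℕ.<-≤-trans p<q q≤n)
    1≤q : 1 ≤ q
    1≤q = ℕ.≤-trans 1≤p (ℕ.<⇒≤ p<q)
    1≤r : 1 ≤ r
    1≤r = ℕ.≤-trans 1≤q (ℕ.<⇒≤ q<r)

  private
    T-∨ʳ : ∀ {x y} → T y → T (x ∨ y)
    T-∨ʳ = Equivalence.from Bool.T-∨ ∘ inj₂

  edgeIn-pq : ∀ p q r → T (edgeIn (p , q) (p , q , r))
  edgeIn-pq p q r rewrite ≡ᵇ-refl p | ≡ᵇ-refl q = _

  edgeIn-qr : ∀ p q r → T (edgeIn (q , r) (p , q , r))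
  edgeIn-qr p q r rewrite ≡ᵇ-refl q | ≡ᵇ-refl r = T-∨ʳ {(q ≡ᵇ p) ∧ (r ≡ᵇ q)} _

  edgeIn-pr : ∀ p q r → T (edgeIn (p , r) (p , q , r))
  edgeIn-pr p q r rewrite ≡ᵇ-refl p | ≡ᵇ-refl r = T-∨ʳ {r ≡ᵇ q} (T-∨ʳ {(p ≡ᵇ q) ∧ true} _)

  eqE-true : ∀ x y → eqE x y ≡ true → x ≡ y
  eqE-true (i , j) (k , l) eq with i ≡ᵇ k in i≡ᵇk | j ≡ᵇ l in j≡ᵇl
  ... | true | true = ≡.cong₂ _,_ (ℕ.≡ᵇ⇒≡ i k (≡.subst T (≡.sym i≡ᵇk) _)) (ℕ.≡ᵇ⇒≡ j l (≡.subst T (≡.sym j≡ᵇl) _))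

  eqE-functional : ∀ e x y → eqE e x ≡ true → eqE e y ≡ true → x ≡ y
  eqE-functional e x y e≡x e≡y = ≡.trans (≡.sym (eqE-true e x e≡x)) (eqE-true e y e≡y)

  eqE-comm : ∀ x y → eqE x y ≡ eqE y x
  eqE-comm (i , j) (k , l) = ≡.cong₂ _∧_ (≡ᵇ-comm i k) (≡ᵇ-comm j l)
    where
    ≡ᵇ-comm : ∀ m n → (m ≡ᵇ n) ≡ (n ≡ᵇ m)
    ≡ᵇ-comm zero    zero    = ≡.refl
    ≡ᵇ-comm zero    (suc n) = ≡.refl
    ≡ᵇ-comm (suc m) zero    = ≡.refl
    ≡ᵇ-comm (suc m) (suc n) = ≡ᵇ-comm m n

  edgeIn-cases : ∀ {e p q r} → edgeIn e (p , q , r) ≡ true → e ≡ (p , q) ⊎ e ≡ (q , r) ⊎ e ≡ (p , r)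
  edgeIn-cases {e} {p} {q} {r} in-t with eqE e (p , q) in e₁ | eqE e (q , r) in e₂ | eqE e (p , r) in e₃
  ... | true  | _     | _    = inj₁ (eqE-true e (p , q) e₁)
  ... | false | true  | _    = inj₂ (inj₁ (eqE-true e (q , r) e₂))
  ... | false | false | true = inj₂ (inj₂ (eqE-true e (p , r) e₃))

  edgeIn-sorted : ∀ {i j p q r} → p < q → q < r → edgeIn (i , j) (p , q , r) ≡ true → i < j
  edgeIn-sorted {i} {j} {p} {q} {r} p<q q<r in-t with edgeIn-cases {i , j} {p} {q} {r} in-t
  ... | inj₁ ≡.refl        = p<q
  ... | inj₂ (inj₁ ≡.refl) = q<r
  ... | inj₂ (inj₂ ≡.refl) = ℕ.<-trans p<q q<r

  ∈-triangles⁻ : ∀ {t} → t ∈ Ts → ∃[ p ] ∃[ q ] ∃[ r ] t ≡ (p , q , r) × p < q × q ≤ c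
  ∈-triangles⁻ t∈
    with p , _ , _ , t∈₁   ← ∈-concatMap-verts⁻ (λ p → concatMap (triangles-at p) (verts n)) n t∈
    with q , _ , _ , t∈₂   ← ∈-concatMap-verts⁻ (triangles-at p) n t∈₁
    with r , _ , r≤n , t∈₃ ← ∈-concatMap-verts⁻ (triangle-or-[] p q) n t∈₂
    with isT , ≡.refl      ← ∈-if-singleton⁻ {x = p , q , r} (isTriangleᵇ p q r) t∈₃
    with p<q , q<r         ← isTriangleᵇ⇒sorted {p} {q} {r} isT
    = p , q , r , ≡.refl , p<q , ℕ.≤ᵇ⇒≤ q c (≡.subst T (isTriangleᵇ-sorted p<q q<r r≤n) isT)

  triangle-edge-≤c : ∀ {t i j} → t ∈ Ts → T (edgeIn (i , j) t) → i ≤ c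
  triangle-edge-≤c {i = i} {j} t∈ e = edge-≤c (∈-triangles⁻ t∈) (Equivalence.to Bool.T-≡ e)
    where
    edge-≤c : ∀ {t} → ∃[ p ] ∃[ q ] ∃[ r ] t ≡ (p , q , r) × p < q × q ≤ c → edgeIn (i , j) t ≡ true → i ≤ c
    edge-≤c (p , q , r , ≡.refl , p<q , q≤c) in-t with edgeIn-cases {i , j} {p} {q} {r} in-t
    ... | inj₁ ≡.refl        = ℕ.<⇒≤ (ℕ.<-≤-trans p<q q≤c)
    ... | inj₂ (inj₁ ≡.refl) = q≤c
    ... | inj₂ (inj₂ ≡.refl) = ℕ.<⇒≤ (ℕ.<-≤-trans p<q q≤c)

  ∈-triangles-1 : ∀ {q r} → 1 < q → q < r → r ≤ n → q ≤ c → (1 , q , r) ∈ Ts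
  ∈-triangles-1 1<q q<r r≤n q≤c =
    ∈-triangles⁺ (s≤s z≤n) r≤n (≡.subst T (≡.sym (isTriangleᵇ-sorted 1<q q<r r≤n)) (ℕ.≤⇒≤ᵇ q≤c))

  triangle-through : 3 ≤ c → ∀ {i j} → 1 ≤ i → i < j → j ≤ n → i ≤ c → ∃[ t ] t ∈ Ts × T (edgeIn (i , j) t)
  triangle-through 3≤c {suc (suc i)} {j} _ i<j j≤n i≤c =
    (1 , suc (suc i) , j) , ∈-triangles-1 (s≤s (s≤s z≤n)) i<j j≤n i≤c , edgeIn-qr 1 (suc (suc i)) j
  triangle-through 3≤c {1} {2} _ _ _ _ =
    (1 , 2 , 3) , ∈-triangles-1 (ℕ.n<1+n 1) (ℕ.n<1+n 2) (ℕ.≤-trans 3≤c (ℕ.m≤m+n c b)) (ℕ.≤-trans (ℕ.n≤1+n 2) 3≤c) ,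
    edgeIn-pq 1 2 3
  triangle-through _   {1} {1} _ (s≤s ()) _ _
  triangle-through 3≤c {1} {suc (suc (suc j))} _ _ j≤n _ =
    (1 , 2 , suc (suc (suc j))) , ∈-triangles-1 (ℕ.n<1+n 1) (s≤s (s≤s (s≤s z≤n))) j≤n (ℕ.≤-trans (ℕ.n≤1+n 2) 3≤c) ,
    edgeIn-pr 1 2 (suc (suc (suc j)))

  edge-or-[] : ℕ → ℕ → List Edge
  edge-or-[] i j = if (i <ᵇ j) ∧ any (edgeIn (i , j)) Ts then (i , j) ∷ [] else []

  edges-at : ℕ → List Edge
  edges-at i = concatMap (edge-or-[] i) (verts n)

  data SupportEdge : Edge → Set where
    clique : ∀ {a d} → 1 ≤ a → a < d → d ≤ c → SupportEdge (a , d)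
    cross  : ∀ {a x} → 1 ≤ a → a ≤ c → c < x → x ≤ n → SupportEdge (a , x)

  ∈-support⁻ : ∀ {e} → e ∈ Es → SupportEdge e
  ∈-support⁻ e∈
    with i , 1≤i , _ , e∈₁ ← ∈-concatMap-verts⁻ edges-at n e∈
    with j , _ , j≤n , e∈₂ ← ∈-concatMap-verts⁻ (edge-or-[] i) n e∈₁
    with isE , ≡.refl ← ∈-if-singleton⁻ ((i <ᵇ j) ∧ any (edgeIn (i , j)) Ts) e∈₂
    with i<ᵇj , inT ← Equivalence.to Bool.T-∧ isE
    with t , t∈ , e∈t ← find (any⁻ (edgeIn (i , j)) Ts inT)
    with j ℕ.≤? c
  ... | yes j≤c = clique 1≤i (ℕ.<ᵇ⇒< i j i<ᵇj) j≤c
  ... | no  j≰c = cross 1≤i (triangle-edge-≤c {i = i} {j} t∈ e∈t) (ℕ.≰⇒> j≰c) j≤n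

  edge∈support : 3 ≤ c → ∀ {i j} → 1 ≤ i → i < j → j ≤ n → i ≤ c → (i , j) ∈ Es
  edge∈support 3≤c {i} {j} 1≤i i<j j≤n i≤c with triangle-through 3≤c 1≤i i<j j≤n i≤c
  ... | t , t∈ , e∈t =
    ∈-concatMap-verts⁺ edges-at n 1≤i (ℕ.<⇒≤ (ℕ.<-≤-trans i<j j≤n))
      (∈-concatMap-verts⁺ (edge-or-[] i) n (ℕ.≤-trans 1≤i (ℕ.<⇒≤ i<j)) j≤n
        (∈-if-singleton⁺ ((i <ᵇ j) ∧ any (edgeIn (i , j)) Ts)
          (Equivalence.from Bool.T-∧ (ℕ.<⇒<ᵇ i<j , any⁺ (edgeIn (i , j)) (lose t∈ e∈t)))))

  ∈-support⁺ : 3 ≤ c → ∀ {e} → SupportEdge e → e ∈ Es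
  ∈-support⁺ 3≤c (clique 1≤a a<d d≤c)     = edge∈support 3≤c 1≤a a<d (ℕ.≤-trans d≤c (ℕ.m≤m+n c b)) (ℕ.<⇒≤ (ℕ.<-≤-trans a<d d≤c))
  ∈-support⁺ 3≤c (cross 1≤a a≤c c<x x≤n) = edge∈support 3≤c 1≤a (ℕ.≤-<-trans a≤c c<x) x≤n a≤c

module ListSums {k ℓ} (F : OrderedField k ℓ) where
  open import Data.Nat using (zero; suc)
  open import Data.Bool using (true; false; if_then_else_)
  open import Data.List using (List; []; _∷_; _++_; [_]; map; concatMap; upTo)
  open import Data.List.Properties using (upTo-∷ʳ; map-++)
  open import Relation.Binary.PropositionalEquality as ≡ using ()
  open OrderedField F
  open FiniteSums commRing
  open import Relation.Binary.Reasoning.Setoid setoid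

  sumL-++ : ∀ {A : Set} (xs ys : List A) f → sumL F (xs ++ ys) f ≈ sumL F xs f + sumL F ys f
  sumL-++ []       ys f = sym (+-identityˡ _)
  sumL-++ (x ∷ xs) ys f = trans (+-congˡ (sumL-++ xs ys f)) (sym (+-assoc _ _ _))

  sumL-if-singleton : ∀ {A : Set} b (x : A) f → sumL F (if b then x ∷ [] else []) f ≈ (if b then f x else 0#)
  sumL-if-singleton true  x f = +-identityʳ (f x)
  sumL-if-singleton false x f = refl

  sumL-concatMap : ∀ {A B : Set} (g : A → List B) xs f → sumL F (concatMap g xs) f ≈ sumL F xs (λ x → sumL F (g x) f)
  sumL-concatMap g []       f = refl
  sumL-concatMap g (x ∷ xs) f = trans (sumL-++ (g x) (concatMap g xs) f) (+-congˡ (sumL-concatMap g xs f))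

  sumL-verts : ∀ n f → sumL F (verts n) f ≈ ∑ n f
  sumL-verts zero    f = refl
  sumL-verts (suc n) f = begin
    sumL F (map suc (upTo (suc n))) f    ≡⟨ ≡.cong (λ xs → sumL F (map suc xs) f) (≡.sym (upTo-∷ʳ n)) ⟩
    sumL F (map suc (upTo n ++ [ n ])) f ≡⟨ ≡.cong (λ xs → sumL F xs f) (map-++ suc (upTo n) [ n ]) ⟩
    sumL F (verts n ++ [ suc n ]) f      ≈⟨ sumL-++ (verts n) [ suc n ] f ⟩
    sumL F (verts n) f + (f (suc n) + 0#) ≈⟨ +-cong (sumL-verts n f) (+-identityʳ _) ⟩
    ∑ n f + f (suc n)                    ∎

  sumL-concatMap-verts : ∀ {A : Set} n (g : ℕ → List A) f → sumL F (concatMap g (verts n)) f ≈ ∑ n (λ i → sumL F (g i) f)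
  sumL-concatMap-verts n g f = trans (sumL-concatMap g (verts n) f) (sumL-verts n _)

module Laplacian {k ℓ} (F : OrderedField k ℓ) (c b : ℕ) where
  open import Data.Nat as ℕ using (_<_; _<ᵇ_; _≤ᵇ_)
  open import Data.Nat.Properties as ℕ using ()
  open import Data.Bool using (true; false; T; if_then_else_; _∧_; _∨_)
  open import Data.Bool.Properties as Bool using ()
  open import Data.Bool.ListAction using (any)
  open import Data.List using (List; concatMap)
  open import Data.List.Membership.Propositional using (_∈_; lose)
  open import Data.List.Relation.Unary.Any.Properties using (any⁺)
  open import Data.Product using (_,_; proj₁; proj₂)
  open import Data.Empty using (⊥-elim)
  open import Function using (Equivalence)
  open import Relation.Nullary using (yes; no)
  open import Relation.Binary.Definitions using (tri<; tri≈; tri>)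
  open import Relation.Binary.PropositionalEquality as ≡ using (_≡_)
  open BooleanComparisons
  open OrderedField F hiding (_<_)
  open IntegerCoefficientSolver commRing
  open import Algebra.Properties.Ring ring using (-0#≈0#; -‿involutive)
  open OrderedFieldProperties F using (∑-const-fromℕ)
  open FiniteSums commRing
  open ListSums F
  open Graph c b
  open import Relation.Binary.Reasoning.Setoid setoid

  δ₁ : (Edge → Carrier) → Triangle → Carrier
  δ₁ v t = sumL F Es (λ f → inc F t f * v f)

  Δ : (Edge → Carrier) → Edge → Carrier
  Δ = lap F Ts Es

  triangle-sum : ∀ g → sumL F Ts g ≈ ∑ n (λ p → ∑ n (λ q → ∑ n (λ r → if isTriangleᵇ p q r then g (p , q , r) else 0#)))
  triangle-sum g =
    trans (sumL-concatMap-verts n (λ p → concatMap (triangles-at p) (verts n)) g) (∑-cong n (λ p →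
    trans (sumL-concatMap-verts n (triangles-at p) g) (∑-cong n (λ q →
    trans (sumL-concatMap-verts n (triangle-or-[] p q) g) (∑-cong n (λ r →
    sumL-if-singleton (isTriangleᵇ p q r) (p , q , r) g))))))

  edge-sum : ∀ h → sumL F Es h ≈ ∑ n (λ i → ∑ n (λ j → if (i <ᵇ j) ∧ any (edgeIn (i , j)) Ts then h (i , j) else 0#))
  edge-sum h =
    trans (sumL-concatMap-verts n edges-at h) (∑-cong n (λ i →
    trans (sumL-concatMap-verts n (edge-or-[] i) h) (∑-cong n (λ j →
    sumL-if-singleton ((i <ᵇ j) ∧ any (edgeIn (i , j)) Ts) (i , j) h))))

  inc-expand : ∀ {p q r} → p < q → q < r → ∀ e →
               inc F (p , q , r) e ≈ 𝟙 (eqE e (p , q)) + 𝟙 (eqE e (q , r)) - 𝟙 (eqE e (p , r))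
  inc-expand {p} {q} {r} p<q q<r (i , j)
    with eqE (i , j) (p , q) in e₁ | eqE (i , j) (q , r) in e₂ | eqE (i , j) (p , r) in e₃
  ... | true  | true  | _     = ⊥-elim (ℕ.<-irrefl (≡.cong proj₁ (eqE-functional (i , j) (p , q) (q , r) e₁ e₂)) p<q)
  ... | true  | false | true  = ⊥-elim (ℕ.<-irrefl (≡.cong proj₂ (eqE-functional (i , j) (p , q) (p , r) e₁ e₃)) q<r)
  ... | false | true  | true  = ⊥-elim (ℕ.<-irrefl (≡.cong proj₁ (eqE-functional (i , j) (p , r) (q , r) e₃ e₂)) p<q)
  ... | true  | false | false = solve 0 (:1 := :1 :+ :0 :- :0) refl
  ... | false | true  | false = solve 0 (:1 := :0 :+ :1 :- :0) refl
  ... | false | false | true  = solve 0 (:- :1 := :0 :+ :0 :- :1) refl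
  ... | false | false | false = solve 0 (:0 := :0 :+ :0 :- :0) refl

  inc-off : ∀ {p q r} e → edgeIn e (p , q , r) ≡ false → inc F (p , q , r) e ≈ 0#
  inc-off {p} {q} {r} e off with eqE e (p , q) | eqE e (q , r) | eqE e (p , r)
  ... | false | false | false = refl

  distribʳ-+- : ∀ x y z w → (x + y - z) * w ≈ x * w + y * w - z * w
  distribʳ-+- = solve 4 (λ x y z w → (x :+ y :- z) :* w := x :* w :+ y :* w :- z :* w) refl

  x+0-0≈x : ∀ x → x + 0# - 0# ≈ x
  x+0-0≈x = solve 1 (λ x → x :+ :0 :- :0 := x) refl

  0+x-0≈x : ∀ x → 0# + x - 0# ≈ x
  0+x-0≈x = solve 1 (λ x → :0 :+ x :- :0 := x) refl

  0+0-x≈-x : ∀ x → 0# + 0# - x ≈ - x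
  0+0-x≈-x = solve 1 (λ x → :0 :+ :0 :- x := :- x) refl

  x≈0⇒if≈x : ∀ b {x} → x ≈ 0# → (if b then x else 0#) ≈ x
  x≈0⇒if≈x true  x≈0 = refl
  x≈0⇒if≈x false x≈0 = sym x≈0

  module Cochain (v : Edge → Carrier) where

    W : ℕ → ℕ → Carrier
    W i j = if i <ᵇ j then v (i , j) else if j <ᵇ i then - v (j , i) else 0#

    W-< : ∀ {i j} → i < j → W i j ≈ v (i , j)
    W-< i<j rewrite <ᵇ-true i<j = refl

    W-anti : ∀ i j → W j i ≈ - W i j
    W-anti i j with ℕ.<-cmp i j
    ... | tri< i<j _ _ rewrite <ᵇ-false (ℕ.<⇒≤ i<j) | <ᵇ-true i<j = refl
    ... | tri≈ _ ≡.refl _ rewrite <ᵇ-false (ℕ.≤-refl {i}) = sym -0#≈0#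
    ... | tri> _ _ j<i rewrite <ᵇ-false (ℕ.<⇒≤ j<i) | <ᵇ-true j<i = sym (-‿involutive _)

    W-diag : ∀ i → W i i ≈ 0#
    W-diag i rewrite <ᵇ-false (ℕ.≤-refl {i}) = refl

    δ : ℕ → ℕ → ℕ → Carrier
    δ p q r = W p q + W q r + W r p

    δ-sorted : ∀ {p q r} → p < q → q < r → δ p q r ≈ v (p , q) + v (q , r) - v (p , r)
    δ-sorted {p} {q} {r} p<q q<r =
      +-cong (+-cong (W-< p<q) (W-< q<r)) (trans (W-anti p r) (-‿cong (W-< (ℕ.<-trans p<q q<r))))

    δᴳ : ℕ → ℕ → ℕ → Carrier
    δᴳ p q r = if isTriangleᵇ p q r then δ p q r else 0#

    δ₁-triangle : ∀ {p q r} → 1 ≤ p → r ≤ n → T (isTriangleᵇ p q r) → δ₁ v (p , q , r) ≈ δ p q r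
    δ₁-triangle {p} {q} {r} 1≤p r≤n isT = begin
      δ₁ v t
        ≈⟨ edge-sum _ ⟩
      ∑ n (λ i → ∑ n (λ j → if (i <ᵇ j) ∧ any (edgeIn (i , j)) Ts then inc F t (i , j) * v (i , j) else 0#))
        ≈⟨ ∑-cong n (λ i → ∑-cong n (λ j → on-support i j)) ⟩
      ∑ n (λ i → ∑ n (λ j → inc F t (i , j) * v (i , j)))
        ≈⟨ ∑-cong n (λ i → ∑-cong n (λ j → trans (*-congʳ (inc-expand p<q q<r (i , j))) (distribʳ-+- _ _ _ _))) ⟩
      ∑ n (λ i → ∑ n (λ j → 𝟙 (eqE (i , j) (p , q)) * f i j + 𝟙 (eqE (i , j) (q , r)) * f i j - 𝟙 (eqE (i , j) (p , r)) * f i j))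
        ≈⟨ ∑∑-distrib-+- n n _ _ _ ⟩
      _ + _ - _
        ≈⟨ +-cong (+-cong (∑∑-delta n f 1≤p p≤n 1≤q q≤n) (∑∑-delta n f 1≤q q≤n 1≤r r≤n))
                  (-‿cong (∑∑-delta n f 1≤p p≤n 1≤r r≤n)) ⟩
      v (p , q) + v (q , r) - v (p , r)
        ≈⟨ sym (δ-sorted p<q q<r) ⟩
      δ p q r ∎
      where
      t : Triangle
      t = (p , q , r)
      f : ℕ → ℕ → Carrier
      f i j = v (i , j)
      p<q : p < q
      p<q = proj₁ (isTriangleᵇ⇒sorted {p} {q} {r} isT)
      q<r : q < r
      q<r = proj₂ (isTriangleᵇ⇒sorted {p} {q} {r} isT)
      q≤n : q ≤ n
      q≤n = ℕ.<⇒≤ (ℕ.<-≤-trans q<r r≤n)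
      p≤n : p ≤ n
      p≤n = ℕ.<⇒≤ (ℕ.<-≤-trans p<q q≤n)
      1≤q : 1 ≤ q
      1≤q = ℕ.≤-trans 1≤p (ℕ.<⇒≤ p<q)
      1≤r : 1 ≤ r
      1≤r = ℕ.≤-trans 1≤q (ℕ.<⇒≤ q<r)
      t∈Ts : t ∈ Ts
      t∈Ts = ∈-triangles⁺ 1≤p r≤n isT
      on-support : ∀ i j → (if (i <ᵇ j) ∧ any (edgeIn (i , j)) Ts then inc F t (i , j) * v (i , j) else 0#)
                           ≈ inc F t (i , j) * v (i , j)
      on-support i j with edgeIn (i , j) t in i,j∈t
      ... | true rewrite <ᵇ-true (edgeIn-sorted {i} {j} {p} {q} {r} p<q q<r i,j∈t)
                       | Equivalence.to Bool.T-≡ (any⁺ (edgeIn (i , j)) (lose t∈Ts (Equivalence.from Bool.T-≡ i,j∈t))) = refl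
      ... | false = x≈0⇒if≈x _ (trans (*-congʳ (inc-off (i , j) i,j∈t)) (zeroˡ _))

    Δ-expand : ∀ {a d} → 1 ≤ a → a ≤ n → 1 ≤ d → d ≤ n →
               Δ v (a , d) ≈ ∑ n (λ k → δᴳ a d k + δᴳ k a d - δᴳ a k d)
    Δ-expand {a} {d} 1≤a a≤n 1≤d d≤n = begin
      Δ v e
        ≈⟨ triangle-sum _ ⟩
      ∑ n (λ p → ∑ n (λ q → ∑ n (λ r → if isTriangleᵇ p q r then inc F (p , q , r) e * δ₁ v (p , q , r) else 0#)))
        ≈⟨ ∑-cong-on n (λ 1≤p _ → ∑-cong n (λ q → ∑-cong-on n (λ _ r≤n → on-triangle 1≤p r≤n))) ⟩
      ∑ n (λ p → ∑ n (λ q → ∑ n (λ r → (𝟙 (eqE e (p , q)) + 𝟙 (eqE e (q , r)) - 𝟙 (eqE e (p , r))) * δᴳ p q r)))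
        ≈⟨ ∑-cong n (λ p → trans (∑-cong n (λ q → ∑-cong n (λ r → distribʳ-+- _ _ _ _))) (∑∑-distrib-+- n n _ _ _)) ⟩
      ∑ n (λ p → ∑ n (λ q → ∑ n (λ r → 𝟙 (eqE e (p , q)) * δᴳ p q r)) + ∑ n (λ q → ∑ n (λ r → 𝟙 (eqE e (q , r)) * δᴳ p q r))
                 - ∑ n (λ q → ∑ n (λ r → 𝟙 (eqE e (p , r)) * δᴳ p q r)))
        ≈⟨ ∑-distrib-+- n _ _ _ ⟩
      _ + _ - _
        ≈⟨ +-cong (+-cong collapse₁ collapse₂) (-‿cong collapse₃) ⟩
      ∑ n (δᴳ a d) + ∑ n (λ k → δᴳ k a d) - ∑ n (λ k → δᴳ a k d)
        ≈⟨ sym (∑-distrib-+- n _ _ _) ⟩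
      ∑ n (λ k → δᴳ a d k + δᴳ k a d - δᴳ a k d) ∎
      where
      e : Edge
      e = (a , d)

      on-triangle : ∀ {p q r} → 1 ≤ p → r ≤ n →
        (if isTriangleᵇ p q r then inc F (p , q , r) e * δ₁ v (p , q , r) else 0#) ≈
        (𝟙 (eqE e (p , q)) + 𝟙 (eqE e (q , r)) - 𝟙 (eqE e (p , r))) * δᴳ p q r
      on-triangle {p} {q} {r} 1≤p r≤n with isTriangleᵇ p q r in isT
      ... | true  = trans (*-congˡ (δ₁-triangle 1≤p r≤n isTᵀ)) (*-congʳ (inc-expand p<q q<r e))
        where
        isTᵀ : T (isTriangleᵇ p q r)
        isTᵀ = Equivalence.from Bool.T-≡ isT
        p<q : p < q
        p<q = proj₁ (isTriangleᵇ⇒sorted {p} {q} {r} isTᵀ)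
        q<r : q < r
        q<r = proj₂ (isTriangleᵇ⇒sorted {p} {q} {r} isTᵀ)
      ... | false = sym (zeroʳ _)

      ∑∑-delta-at : (f : ℕ → ℕ → Carrier) → ∑ n (λ i → ∑ n (λ j → 𝟙 (eqE e (i , j)) * f i j)) ≈ f a d
      ∑∑-delta-at f = trans (∑-cong n (λ i → ∑-cong n (λ j → *-congʳ (reflexive (≡.cong 𝟙 (eqE-comm e (i , j)))))))
                            (∑∑-delta n f 1≤a a≤n 1≤d d≤n)

      collapse₁ : ∑ n (λ p → ∑ n (λ q → ∑ n (λ r → 𝟙 (eqE e (p , q)) * δᴳ p q r))) ≈ ∑ n (δᴳ a d)
      collapse₁ = trans (∑-cong n (λ p → ∑-cong n (λ q → sym (*-distribˡ-∑ n _ (δᴳ p q)))))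
                        (∑∑-delta-at (λ p q → ∑ n (δᴳ p q)))

      collapse₂ : ∑ n (λ p → ∑ n (λ q → ∑ n (λ r → 𝟙 (eqE e (q , r)) * δᴳ p q r))) ≈ ∑ n (λ k → δᴳ k a d)
      collapse₂ = ∑-cong n (λ p → ∑∑-delta-at (δᴳ p))

      collapse₃ : ∑ n (λ p → ∑ n (λ q → ∑ n (λ r → 𝟙 (eqE e (p , r)) * δᴳ p q r))) ≈ ∑ n (λ k → δᴳ a k d)
      collapse₃ = trans (∑-cong n (λ p → trans (∑-comm n n _) (∑-cong n (λ r → sym (*-distribˡ-∑ n _ (λ q → δᴳ p q r))))))
                        (∑∑-delta-at (λ p r → ∑ n (λ q → δᴳ p q r)))

    δ-rotate : ∀ p q r → δ p q r ≈ δ q r p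
    δ-rotate p q r = solve 3 (λ x y z → x :+ y :+ z := y :+ z :+ x) refl (W p q) (W q r) (W r p)

    δ-flip : ∀ p q r → δ p r q ≈ - δ p q r
    δ-flip p q r = begin
      W p r + W r q + W q p             ≈⟨ +-cong (+-cong (W-anti r p) (W-anti q r)) (W-anti p q) ⟩
      - W r p + - W q r + - W p q       ≈⟨ solve 3 (λ x y z → :- z :+ :- y :+ :- x := :- (x :+ y :+ z)) refl (W p q) (W q r) (W r p) ⟩
      - (W p q + W q r + W r p)         ∎

    δ-repeat : ∀ p q → δ p q p ≈ 0#
    δ-repeat p q = begin
      W p q + W q p + W p p             ≈⟨ +-cong (+-congˡ (W-anti p q)) (W-diag p) ⟩
      W p q - W p q + 0#                ≈⟨ solve 1 (λ x → x :- x :+ :0 := :0) refl (W p q) ⟩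
      0#                                ∎

    δᴳ-sorted : ∀ {p q r} → p < q → q < r → r ≤ n → δᴳ p q r ≡ (if q ≤ᵇ c then δ p q r else 0#)
    δᴳ-sorted {p} {q} {r} p<q q<r r≤n = ≡.cong (λ β → if β then δ p q r else 0#) (isTriangleᵇ-sorted p<q q<r r≤n)

    δᴳ-unsorted₁ : ∀ {p q r} → q ≤ p → δᴳ p q r ≡ 0#
    δᴳ-unsorted₁ {p} {q} {r} q≤p = ≡.cong (λ β → if β then δ p q r else 0#) (isTriangleᵇ-unsorted₁ {p} {q} {r} q≤p)

    δᴳ-unsorted₂ : ∀ {p q r} → r ≤ q → δᴳ p q r ≡ 0#
    δᴳ-unsorted₂ {p} {q} {r} r≤q = ≡.cong (λ β → if β then δ p q r else 0#) (isTriangleᵇ-unsorted₂ {p} r≤q)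

    -- Of the three orderings of {a, d, k} only the sorted one can be a triangle of G_{c,b}, and it is
    -- one iff its middle vertex lies in the clique, i.e. (as a ≤ c) iff k ≤ c or d ≤ c.
    Δ-summand : ∀ {a d k} → a < d → d ≤ n → a ≤ c → k ≤ n →
      δᴳ a d k + δᴳ k a d - δᴳ a k d ≈ (if (k ≤ᵇ c) ∨ (d ≤ᵇ c) then δ a d k else 0#)
    Δ-summand {a} {d} {k} a<d d≤n a≤c k≤n with ℕ.<-cmp k a
    ... | tri< k<a _ _
      rewrite δᴳ-unsorted₂ {a} {d} {k} (ℕ.<⇒≤ (ℕ.<-trans k<a a<d)) | δᴳ-sorted k<a a<d d≤n
            | δᴳ-unsorted₁ {a} {k} {d} (ℕ.<⇒≤ k<a) | ≤ᵇ-true a≤c | ≤ᵇ-true (ℕ.<⇒≤ (ℕ.<-≤-trans k<a a≤c))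
      = trans (0+x-0≈x (δ k a d)) (δ-rotate k a d)
    ... | tri≈ _ ≡.refl _
      rewrite δᴳ-unsorted₂ {a} {d} {a} (ℕ.<⇒≤ a<d) | δᴳ-unsorted₁ {a} {a} {d} ℕ.≤-refl
      = trans (0+x-0≈x 0#) (sym (trans (x≈0⇒if≈x _ (δ-repeat a d)) (δ-repeat a d)))
    ... | tri> _ _ a<k with ℕ.<-cmp k d
    ...   | tri< k<d _ _
      rewrite δᴳ-unsorted₂ {a} {d} {k} (ℕ.<⇒≤ k<d) | δᴳ-unsorted₁ {k} {a} {d} (ℕ.<⇒≤ a<k) | δᴳ-sorted a<k k<d d≤n
      with k ℕ.≤? c
    ...     | yes k≤c rewrite ≤ᵇ-true k≤c =
      trans (0+0-x≈-x (δ a k d)) (trans (-‿cong (δ-flip a d k)) (-‿involutive _))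
    ...     | no  k≰c rewrite ≤ᵇ-false (ℕ.≰⇒> k≰c) | ≤ᵇ-false (ℕ.<-trans (ℕ.≰⇒> k≰c) k<d) = 0+x-0≈x 0#
    Δ-summand {a} {d} {k} a<d d≤n a≤c k≤n | tri> _ _ a<k | tri≈ _ ≡.refl _
      rewrite δᴳ-unsorted₂ {a} {d} {d} ℕ.≤-refl | δᴳ-unsorted₁ {d} {a} {d} (ℕ.<⇒≤ a<d)
      = trans (0+x-0≈x 0#) (sym (trans (x≈0⇒if≈x _ δadd≈0) δadd≈0))
      where
      δadd≈0 : δ a d d ≈ 0#
      δadd≈0 = trans (δ-rotate a d d) (trans (δ-rotate d d a) (δ-repeat d a))
    Δ-summand {a} {d} {k} a<d d≤n a≤c k≤n | tri> _ _ a<k | tri> _ _ d<k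
      rewrite δᴳ-sorted a<d d<k k≤n | δᴳ-unsorted₁ {k} {a} {d} (ℕ.<⇒≤ a<k) | δᴳ-unsorted₂ {a} {k} {d} (ℕ.<⇒≤ d<k)
      with d ℕ.≤? c
    ...     | yes d≤c rewrite ≤ᵇ-true d≤c | Bool.∨-zeroʳ (k ≤ᵇ c) = x+0-0≈x (δ a d k)
    ...     | no  d≰c rewrite ≤ᵇ-false (ℕ.≰⇒> d≰c) | ≤ᵇ-false (ℕ.<-trans (ℕ.≰⇒> d≰c) d<k) = 0+x-0≈x 0#

    ρ σ : ℕ → Carrier
    ρ x = ∑ n (W x)
    σ x = ∑ c (W x)

    ∑-δ : ∀ m a d → ∑ m (δ a d) ≈ fromℕ F m * W a d + ∑ m (W d) - ∑ m (W a)
    ∑-δ m a d = begin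
      ∑ m (λ k → W a d + W d k + W k a)           ≈⟨ ∑-cong m (λ k → +-congˡ (W-anti a k)) ⟩
      ∑ m (λ k → W a d + W d k - W a k)           ≈⟨ ∑-distrib-+- m _ _ _ ⟩
      ∑ m (λ _ → W a d) + ∑ m (W d) - ∑ m (W a)   ≈⟨ +-congʳ (+-congʳ (∑-const-fromℕ m _)) ⟩
      fromℕ F m * W a d + ∑ m (W d) - ∑ m (W a)   ∎

    Δ-weighted : ∀ {a d} → 1 ≤ a → a < d → d ≤ n → a ≤ c →
                 Δ v (a , d) ≈ ∑ n (λ k → if (k ≤ᵇ c) ∨ (d ≤ᵇ c) then δ a d k else 0#)
    Δ-weighted 1≤a a<d d≤n a≤c =
      trans (Δ-expand 1≤a (ℕ.<⇒≤ (ℕ.<-≤-trans a<d d≤n)) (ℕ.≤-trans 1≤a (ℕ.<⇒≤ a<d)) d≤n)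
            (∑-cong-on n (λ _ k≤n → Δ-summand a<d d≤n a≤c k≤n))

    Δ-clique : ∀ {a d} → 1 ≤ a → a < d → d ≤ c → Δ v (a , d) ≈ fromℕ F n * W a d + ρ d - ρ a
    Δ-clique {a} {d} 1≤a a<d d≤c = begin
      Δ v (a , d)                                          ≈⟨ Δ-weighted 1≤a a<d (ℕ.≤-trans d≤c (ℕ.m≤m+n c b)) (ℕ.<⇒≤ (ℕ.<-≤-trans a<d d≤c)) ⟩
      ∑ n (λ k → if (k ≤ᵇ c) ∨ (d ≤ᵇ c) then δ a d k else 0#) ≈⟨ ∑-cong n weight≈1 ⟩
      ∑ n (δ a d)                                          ≈⟨ ∑-δ n a d ⟩
      fromℕ F n * W a d + ρ d - ρ a                        ∎
      where
      weight≈1 : ∀ k → (if (k ≤ᵇ c) ∨ (d ≤ᵇ c) then δ a d k else 0#) ≈ δ a d k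
      weight≈1 k rewrite ≤ᵇ-true d≤c | Bool.∨-zeroʳ (k ≤ᵇ c) = refl

    Δ-cross : ∀ {a x} → 1 ≤ a → a ≤ c → c < x → x ≤ n → Δ v (a , x) ≈ fromℕ F c * W a x + σ x - σ a
    Δ-cross {a} {x} 1≤a a≤c c<x x≤n = begin
      Δ v (a , x)                                          ≈⟨ Δ-weighted 1≤a (ℕ.≤-<-trans a≤c c<x) x≤n a≤c ⟩
      ∑ n (λ k → if (k ≤ᵇ c) ∨ (x ≤ᵇ c) then δ a x k else 0#) ≈⟨ ∑-split c b _ ⟩
      ∑ c (λ k → if (k ≤ᵇ c) ∨ (x ≤ᵇ c) then δ a x k else 0#)
        + ∑ b (λ t → if (c ℕ.+ t ≤ᵇ c) ∨ (x ≤ᵇ c) then δ a x (c ℕ.+ t) else 0#)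
        ≈⟨ +-cong (∑-cong-on c (λ _ k≤c → clique-weight k≤c)) (∑-zero b (λ 1≤t _ → outer-weight 1≤t)) ⟩
      ∑ c (δ a x) + 0#                                     ≈⟨ +-identityʳ _ ⟩
      ∑ c (δ a x)                                          ≈⟨ ∑-δ c a x ⟩
      fromℕ F c * W a x + σ x - σ a                        ∎
      where
      clique-weight : ∀ {k} → k ≤ c → (if (k ≤ᵇ c) ∨ (x ≤ᵇ c) then δ a x k else 0#) ≈ δ a x k
      clique-weight k≤c rewrite ≤ᵇ-true k≤c = refl
      outer-weight : ∀ {t} → 1 ≤ t → (if (c ℕ.+ t ≤ᵇ c) ∨ (x ≤ᵇ c) then δ a x (c ℕ.+ t) else 0#) ≈ 0#
      outer-weight 1≤t rewrite ≤ᵇ-false (ℕ.m<m+n c 1≤t) | ≤ᵇ-false c<x = refl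

module Spectrum {k ℓ} (F : OrderedField k ℓ) (c b : ℕ) (3≤c : 3 ≤ c) where
  open import Data.Nat as ℕ using (suc; _<_; z≤n; s≤s)
  open import Data.Nat.Properties as ℕ using ()
  open import Data.Product using (_,_)
  open import Data.List.Membership.Propositional using (_∈_)
  open import Relation.Nullary using (¬_)
  open import Relation.Binary.Definitions using (tri<; tri≈; tri>)
  open import Relation.Binary.PropositionalEquality as ≡ using (_≡_; _≢_)
  open OrderedField F hiding (_<_)
  open IntegerCoefficientSolver commRing
  open FiniteSums commRing
  open OrderedFieldProperties F
  open Graph c b
  open Laplacian F c b
  open import Algebra.Properties.Ring ring using (-0#≈0#; -‿distribʳ-*)
  open import Relation.Binary.Reasoning.Setoid setoid

  N C B : Carrier
  N = fromℕ F n
  C = fromℕ F c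
  B = fromℕ F b

  module Eigenvector (v : Edge → Carrier) (μ : Carrier) (eigen : ∀ e → e ∈ Es → Δ v e ≈ μ * v e) where
    open Cochain v

    private
      eigen-clique-< : ∀ {a d} → 1 ≤ a → a < d → d ≤ c → μ * W a d ≈ N * W a d + ρ d - ρ a
      eigen-clique-< {a} {d} 1≤a a<d d≤c = begin
        μ * W a d                     ≈⟨ *-congˡ (W-< a<d) ⟩
        μ * v (a , d)                 ≈⟨ sym (eigen (a , d) (∈-support⁺ 3≤c (clique 1≤a a<d d≤c))) ⟩
        Δ v (a , d)                   ≈⟨ Δ-clique 1≤a a<d d≤c ⟩
        N * W a d + ρ d - ρ a         ∎

    eigen-clique : ∀ {a d} → 1 ≤ a → a ≤ c → 1 ≤ d → d ≤ c → μ * W a d ≈ N * W a d + ρ d - ρ a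
    eigen-clique {a} {d} 1≤a a≤c 1≤d d≤c with ℕ.<-cmp a d
    ... | tri< a<d _ _ = eigen-clique-< 1≤a a<d d≤c
    ... | tri≈ _ ≡.refl _ = begin
      μ * W a a                     ≈⟨ *-congˡ (W-diag a) ⟩
      μ * 0#                        ≈⟨ solve 3 (λ m n r → m :* :0 := n :* :0 :+ r :- r) refl μ N (ρ a) ⟩
      N * 0# + ρ a - ρ a            ≈⟨ +-congʳ (+-congʳ (*-congˡ (sym (W-diag a)))) ⟩
      N * W a a + ρ a - ρ a         ∎
    ... | tri> _ _ d<a = begin
      μ * W a d                     ≈⟨ *-congˡ (W-anti d a) ⟩
      μ * - W d a                   ≈⟨ sym (-‿distribʳ-* μ _) ⟩
      - (μ * W d a)                 ≈⟨ -‿cong (eigen-clique-< 1≤d d<a a≤c) ⟩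
      - (N * W d a + ρ a - ρ d)
        ≈⟨ solve 4 (λ n w r s → :- (n :* w :+ r :- s) := n :* (:- w) :+ s :- r) refl N (W d a) (ρ a) (ρ d) ⟩
      N * - W d a + ρ d - ρ a       ≈⟨ +-congʳ (+-congʳ (*-congˡ (sym (W-anti d a)))) ⟩
      N * W a d + ρ d - ρ a         ∎

    eigen-cross : ∀ {a x} → 1 ≤ a → a ≤ c → c < x → x ≤ n → μ * W a x ≈ C * W a x + σ x - σ a
    eigen-cross {a} {x} 1≤a a≤c c<x x≤n = begin
      μ * W a x                     ≈⟨ *-congˡ (W-< (ℕ.≤-<-trans a≤c c<x)) ⟩
      μ * v (a , x)                 ≈⟨ sym (eigen (a , x) (∈-support⁺ 3≤c (cross 1≤a a≤c c<x x≤n))) ⟩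
      Δ v (a , x)                   ≈⟨ Δ-cross 1≤a a≤c c<x x≤n ⟩
      C * W a x + σ x - σ a         ∎

    τ : ℕ → Carrier
    τ a = ∑ b (λ t → W a (c ℕ.+ t))

    ρ≈σ+τ : ∀ a → ρ a ≈ σ a + τ a
    ρ≈σ+τ a = ∑-split c b (W a)

    R Q : Carrier
    R = ∑ c ρ
    Q = ∑ b (λ t → σ (c ℕ.+ t))

    μσ : ∀ {a} → 1 ≤ a → a ≤ c → μ * σ a ≈ N * σ a + R - C * ρ a
    μσ {a} 1≤a a≤c = begin
      μ * σ a                                   ≈⟨ *-distribˡ-∑ c μ (W a) ⟩
      ∑ c (λ d → μ * W a d)                     ≈⟨ ∑-cong-on c (λ 1≤d d≤c → eigen-clique 1≤a a≤c 1≤d d≤c) ⟩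
      ∑ c (λ d → N * W a d + ρ d - ρ a)         ≈⟨ ∑-distrib-+- c _ _ _ ⟩
      ∑ c (λ d → N * W a d) + R - ∑ c (λ _ → ρ a) ≈⟨ +-cong (+-congʳ (sym (*-distribˡ-∑ c N (W a)))) (-‿cong (∑-const-fromℕ c (ρ a))) ⟩
      N * σ a + R - C * ρ a                     ∎

    μτ : ∀ {a} → 1 ≤ a → a ≤ c → μ * τ a ≈ C * τ a + Q - B * σ a
    μτ {a} 1≤a a≤c = begin
      μ * τ a                                   ≈⟨ *-distribˡ-∑ b μ _ ⟩
      ∑ b (λ t → μ * W a (c ℕ.+ t))             ≈⟨ ∑-cong-on b (λ 1≤t t≤b → eigen-cross 1≤a a≤c (ℕ.m<m+n c 1≤t) (ℕ.+-monoʳ-≤ c t≤b)) ⟩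
      ∑ b (λ t → C * W a (c ℕ.+ t) + σ (c ℕ.+ t) - σ a) ≈⟨ ∑-distrib-+- b _ _ _ ⟩
      ∑ b (λ t → C * W a (c ℕ.+ t)) + Q - ∑ b (λ _ → σ a) ≈⟨ +-cong (+-congʳ (sym (*-distribˡ-∑ b C _))) (-‿cong (∑-const-fromℕ b (σ a))) ⟩
      C * τ a + Q - B * σ a                     ∎

    R+Q≈0 : R + Q ≈ 0#
    R+Q≈0 = begin
      R + Q                      ≈⟨ +-cong R≈T Q≈-T ⟩
      (0# + ∑ c τ) - ∑ c τ       ≈⟨ solve 1 (λ t → (:0 :+ t) :- t := :0) refl (∑ c τ) ⟩
      0#                         ∎
      where
      R≈T : R ≈ 0# + ∑ c τ
      R≈T = trans (∑-cong c ρ≈σ+τ) (trans (∑-distrib-+ c σ τ) (+-congʳ (∑∑-antisymmetric c W W-anti)))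
      Q≈-T : Q ≈ - ∑ c τ
      Q≈-T = begin
        ∑ b (λ t → ∑ c (W (c ℕ.+ t)))              ≈⟨ ∑-cong b (λ t → ∑-cong c (λ a → W-anti a (c ℕ.+ t))) ⟩
        ∑ b (λ t → ∑ c (λ a → - W a (c ℕ.+ t)))    ≈⟨ ∑-cong b (λ t → ∑-distrib-neg c _) ⟩
        ∑ b (λ t → - ∑ c (λ a → W a (c ℕ.+ t)))    ≈⟨ ∑-distrib-neg b _ ⟩
        - ∑ b (λ t → ∑ c (λ a → W a (c ℕ.+ t)))    ≈⟨ -‿cong (∑-comm b c _) ⟩
        - ∑ c τ                                    ∎

    μρ≈0 : ∀ {a} → 1 ≤ a → a ≤ c → μ * ρ a ≈ 0#
    μρ≈0 {a} 1≤a a≤c = begin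
      μ * ρ a                                         ≈⟨ trans (*-congˡ (ρ≈σ+τ a)) (distribˡ μ _ _) ⟩
      μ * σ a + μ * τ a                               ≈⟨ +-cong (μσ 1≤a a≤c) (μτ 1≤a a≤c) ⟩
      (N * σ a + R - C * ρ a) + (C * τ a + Q - B * σ a)
        ≈⟨ +-congʳ (+-cong (+-congʳ (*-congʳ (fromℕ-+ c b))) (-‿cong (*-congˡ (ρ≈σ+τ a)))) ⟩
      ((C + B) * σ a + R - C * (σ a + τ a)) + (C * τ a + Q - B * σ a)
        ≈⟨ solve 6 (λ C B s t R Q → ((C :+ B) :* s :+ R :- C :* (s :+ t)) :+ (C :* t :+ Q :- B :* s) := R :+ Q)
                   refl C B (σ a) (τ a) R Q ⟩
      R + Q                                           ≈⟨ R+Q≈0 ⟩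
      0#                                              ∎

    module Vanishing (μ≉0 : ¬ μ ≈ 0#) (μ≉N : ¬ μ ≈ N) where

      ρ≈0 : ∀ {a} → 1 ≤ a → a ≤ c → ρ a ≈ 0#
      ρ≈0 1≤a a≤c = *-cancelˡ-≉0 μ≉0 (μρ≈0 1≤a a≤c)

      clique-vanishes : ∀ {a d} → 1 ≤ a → a ≤ c → 1 ≤ d → d ≤ c → W a d ≈ 0#
      clique-vanishes {a} {d} 1≤a a≤c 1≤d d≤c = *-cancelʳ-≉ μ≉N (begin
        μ * W a d                 ≈⟨ eigen-clique 1≤a a≤c 1≤d d≤c ⟩
        N * W a d + ρ d - ρ a     ≈⟨ +-cong (+-congˡ (ρ≈0 1≤d d≤c)) (-‿cong (ρ≈0 1≤a a≤c)) ⟩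
        N * W a d + 0# - 0#       ≈⟨ x+0-0≈x (N * W a d) ⟩
        N * W a d                 ∎)

      σ≈0 : ∀ {a} → 1 ≤ a → a ≤ c → σ a ≈ 0#
      σ≈0 1≤a a≤c = ∑-zero c (λ 1≤d d≤c → clique-vanishes 1≤a a≤c 1≤d d≤c)

      cross-vanishes-b≡1 : b ≡ 1 → ∀ {a x} → 1 ≤ a → a ≤ c → c < x → x ≤ n → W a x ≈ 0#
      cross-vanishes-b≡1 ≡.refl {a} {x} 1≤a a≤c c<x x≤n
        with ≡.refl ← ℕ.≤-antisym x≤n (≡.subst (_≤ x) (ℕ.+-comm 1 c) c<x) = begin
        W a (c ℕ.+ 1)             ≈⟨ sym (+-identityˡ _) ⟩
        τ a                       ≈⟨ solve 2 (λ s t → t := (s :+ t) :- s) refl (σ a) (τ a) ⟩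
        (σ a + τ a) - σ a         ≈⟨ +-cong (sym (ρ≈σ+τ a)) (-‿cong (σ≈0 1≤a a≤c)) ⟩
        ρ a - 0#                  ≈⟨ +-congʳ (ρ≈0 1≤a a≤c) ⟩
        0# - 0#                   ≈⟨ -‿inverseʳ 0# ⟩
        0#                        ∎

      cross-vanishes : ¬ μ ≈ C → ∀ {a x} → 1 ≤ a → a ≤ c → c < x → x ≤ n → W a x ≈ 0#
      cross-vanishes μ≉C {a} {x} 1≤a a≤c c<x x≤n =
        *-cancelʳ-≉ μ≉C (trans (eigen-cross′ 1≤a a≤c) (trans (+-congˡ σx≈0) (+-identityʳ _)))
        where
        U : Carrier
        U = ∑ c (λ a′ → W a′ x)
        σx≈-U : σ x ≈ - U
        σx≈-U = trans (∑-cong c (λ a′ → W-anti a′ x)) (∑-distrib-neg c _)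
        eigen-cross′ : ∀ {a′} → 1 ≤ a′ → a′ ≤ c → μ * W a′ x ≈ C * W a′ x + σ x
        eigen-cross′ {a′} 1≤a′ a′≤c = begin
          μ * W a′ x                ≈⟨ eigen-cross 1≤a′ a′≤c c<x x≤n ⟩
          C * W a′ x + σ x - σ a′   ≈⟨ +-congˡ (-‿cong (σ≈0 1≤a′ a′≤c)) ⟩
          C * W a′ x + σ x - 0#     ≈⟨ solve 2 (λ y s → y :+ s :- :0 := y :+ s) refl (C * W a′ x) (σ x) ⟩
          C * W a′ x + σ x          ∎
        μU≈0 : μ * U ≈ 0#
        μU≈0 = begin
          μ * U                                 ≈⟨ *-distribˡ-∑ c μ _ ⟩
          ∑ c (λ a′ → μ * W a′ x)               ≈⟨ ∑-cong-on c eigen-cross′ ⟩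
          ∑ c (λ a′ → C * W a′ x + σ x)         ≈⟨ ∑-distrib-+ c _ _ ⟩
          ∑ c (λ a′ → C * W a′ x) + ∑ c (λ _ → σ x) ≈⟨ +-cong (sym (*-distribˡ-∑ c C _)) (∑-const-fromℕ c (σ x)) ⟩
          C * U + C * σ x                       ≈⟨ +-congˡ (*-congˡ σx≈-U) ⟩
          C * U + C * - U                       ≈⟨ solve 2 (λ C U → C :* U :+ C :* (:- U) := :0) refl C U ⟩
          0#                                    ∎
        σx≈0 : σ x ≈ 0#
        σx≈0 = trans σx≈-U (trans (-‿cong (*-cancelˡ-≉0 μ≉0 μU≈0)) -0#≈0#)

      eigenvector-vanishes : (∀ {a x} → 1 ≤ a → a ≤ c → c < x → x ≤ n → W a x ≈ 0#) →
                             ∀ e → e ∈ Es → v e ≈ 0#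
      eigenvector-vanishes cross≈0 e e∈ with ∈-support⁻ e∈
      ... | clique 1≤a a<d d≤c =
        trans (sym (W-< a<d)) (clique-vanishes 1≤a (ℕ.<⇒≤ (ℕ.<-≤-trans a<d d≤c)) (ℕ.≤-trans 1≤a (ℕ.<⇒≤ a<d)) d≤c)
      ... | cross 1≤a a≤c c<x x≤n = trans (sym (W-< (ℕ.≤-<-trans a≤c c<x))) (cross≈0 1≤a a≤c c<x x≤n)

  no-eigenvalue-b≡1 : b ≡ 1 → ∀ μ → ¬ μ ≈ 0# → ¬ μ ≈ N → ¬ IsEigenvalue F n Ts μ
  no-eigenvalue-b≡1 b≡1 μ μ≉0 μ≉N (v , (e , e∈ , ve≉0) , eigen) =
    ve≉0 (eigenvector-vanishes (cross-vanishes-b≡1 b≡1) e e∈)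
    where open Eigenvector.Vanishing v μ eigen μ≉0 μ≉N

  no-eigenvalue : ∀ μ → ¬ μ ≈ 0# → ¬ μ ≈ N → ¬ μ ≈ C → ¬ IsEigenvalue F n Ts μ
  no-eigenvalue μ μ≉0 μ≉N μ≉C (v , (e , e∈ , ve≉0) , eigen) =
    ve≉0 (eigenvector-vanishes (cross-vanishes μ≉C) e e∈)
    where open Eigenvector.Vanishing v μ eigen μ≉0 μ≉N

  module Wedge (P Q : ℕ → Carrier) where

    wedge : Edge → Carrier
    wedge (i , j) = P i * Q j - P j * Q i

    open Cochain wedge

    W-wedge : ∀ i j → W i j ≈ wedge (i , j)
    W-wedge i j with ℕ.<-cmp i j
    ... | tri< i<j _ _    = W-< i<j
    ... | tri≈ _ ≡.refl _ = trans (W-diag i) (sym (-‿inverseʳ _))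
    ... | tri> _ _ j<i    = trans (W-anti j i) (trans (-‿cong (W-< j<i))
        (solve 4 (λ pj qi pi qj → :- (pj :* qi :- pi :* qj) := pi :* qj :- pj :* qi) refl (P j) (Q i) (P i) (Q j)))

    ∑-W-wedge : ∀ m a → ∑ m P ≈ 0# → ∑ m Q ≈ 0# → ∑ m (W a) ≈ 0#
    ∑-W-wedge m a ∑P≈0 ∑Q≈0 = begin
      ∑ m (W a)                                       ≈⟨ ∑-cong m (W-wedge a) ⟩
      ∑ m (λ k → P a * Q k - P k * Q a)               ≈⟨ ∑-distrib-+ m _ _ ⟩
      ∑ m (λ k → P a * Q k) + ∑ m (λ k → - (P k * Q a))
        ≈⟨ +-cong (sym (*-distribˡ-∑ m (P a) Q)) (trans (∑-distrib-neg m _) (-‿cong (sym (*-distribʳ-∑ m (Q a) P)))) ⟩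
      P a * ∑ m Q - ∑ m P * Q a                       ≈⟨ +-cong (*-congˡ ∑Q≈0) (-‿cong (*-congʳ ∑P≈0)) ⟩
      P a * 0# - 0# * Q a                             ≈⟨ solve 2 (λ p q → p :* :0 :- :0 :* q := :0) refl (P a) (Q a) ⟩
      0#                                              ∎

    wedge-eigenvector : ∀ μ → ∑ n P ≈ 0# → ∑ n Q ≈ 0# → ∑ c P ≈ 0# → ∑ c Q ≈ 0# →
      (∀ {a d} → 1 ≤ a → a < d → d ≤ c → N * wedge (a , d) ≈ μ * wedge (a , d)) →
      (∀ {a x} → 1 ≤ a → a ≤ c → c < x → x ≤ n → C * wedge (a , x) ≈ μ * wedge (a , x)) →
      ∀ e → e ∈ Es → Δ wedge e ≈ μ * wedge e
    wedge-eigenvector μ ∑ⁿP ∑ⁿQ ∑ᶜP ∑ᶜQ on-clique on-cross e e∈ with ∈-support⁻ e∈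
    ... | clique {a} {d} 1≤a a<d d≤c = begin
      Δ wedge (a , d)               ≈⟨ Δ-clique 1≤a a<d d≤c ⟩
      N * W a d + ρ d - ρ a         ≈⟨ +-cong (+-cong (*-congˡ (W-wedge a d)) (∑-W-wedge n d ∑ⁿP ∑ⁿQ)) (-‿cong (∑-W-wedge n a ∑ⁿP ∑ⁿQ)) ⟩
      N * wedge (a , d) + 0# - 0#   ≈⟨ x+0-0≈x _ ⟩
      N * wedge (a , d)             ≈⟨ on-clique 1≤a a<d d≤c ⟩
      μ * wedge (a , d)             ∎
    ... | cross {a} {x} 1≤a a≤c c<x x≤n = begin
      Δ wedge (a , x)               ≈⟨ Δ-cross 1≤a a≤c c<x x≤n ⟩
      C * W a x + σ x - σ a         ≈⟨ +-cong (+-cong (*-congˡ (W-wedge a x)) (∑-W-wedge c x ∑ᶜP ∑ᶜQ)) (-‿cong (∑-W-wedge c a ∑ᶜP ∑ᶜQ)) ⟩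
      C * wedge (a , x) + 0# - 0#   ≈⟨ x+0-0≈x _ ⟩
      C * wedge (a , x)             ≈⟨ on-cross 1≤a a≤c c<x x≤n ⟩
      μ * wedge (a , x)             ∎

    wedge-vanishes : ∀ {i j} → P j ≈ 0# → Q j ≈ 0# → wedge (i , j) ≈ 0#
    wedge-vanishes {i} {j} Pj≈0 Qj≈0 = trans (+-cong (*-congˡ Qj≈0) (-‿cong (*-congʳ Pj≈0)))
      (solve 2 (λ p q → p :* :0 :- :0 :* q := :0) refl (P i) (Q i))

    wedge-vanishes-Q : ∀ {i j} → Q i ≈ 0# → Q j ≈ 0# → wedge (i , j) ≈ 0#
    wedge-vanishes-Q {i} {j} Qi≈0 Qj≈0 = trans (+-cong (*-congˡ Qj≈0) (-‿cong (*-congˡ Qi≈0)))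
      (solve 2 (λ p p′ → p :* :0 :- p′ :* :0 := :0) refl (P i) (P j))

    wedge≉0 : ∀ {i j} → P i ≈ 1# → Q j ≈ 1# → P j ≈ 0# → Q i ≈ 0# → ¬ wedge (i , j) ≈ 0#
    wedge≉0 Pi≈1 Qj≈1 Pj≈0 Qi≈0 w≈0 = <⇒≉ 0<1 (sym (begin
      1#                  ≈⟨ solve 0 (:1 := :1 :* :1 :- :0 :* :0) refl ⟩
      1# * 1# - 0# * 0#   ≈⟨ sym (+-cong (*-cong Pi≈1 Qj≈1) (-‿cong (*-cong Pj≈0 Qi≈0))) ⟩
      wedge _             ≈⟨ w≈0 ⟩
      0#                  ∎))

  private
    w≈0⇒x*w≈y*w : ∀ {x y w} → w ≈ 0# → x * w ≈ y * w
    w≈0⇒x*w≈y*w {x} {y} w≈0 = trans (*-congˡ w≈0) (trans (zeroʳ x) (sym (trans (*-congˡ w≈0) (zeroʳ y))))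

    c≤n : c ≤ n
    c≤n = ℕ.m≤m+n c b


  N-is-eigenvalue : IsEigenvalue F n Ts N
  N-is-eigenvalue =
    wedge , ((1 , 2) , ∈-support⁺ 3≤c (clique (s≤s z≤n) (s≤s (s≤s z≤n)) 2≤c) ,
             wedge≉0 {1} {2} (dipole-at 1 3 (λ ())) (dipole-at 2 3 (λ ()))
                             (dipole-off 1 3 {2} (λ ()) (λ ())) (dipole-off 2 3 {1} (λ ()) (λ ()))) ,
    wedge-eigenvector N (∑-dipole n 1≤1 (ℕ.≤-trans 1≤3 3≤n) 1≤3 3≤n) (∑-dipole n 1≤2 (ℕ.≤-trans 2≤3 3≤n) 1≤3 3≤n)
                        (∑-dipole c 1≤1 (ℕ.≤-trans 1≤3 3≤c) 1≤3 3≤c) (∑-dipole c 1≤2 2≤c 1≤3 3≤c)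
                        (λ _ _ _ → refl) on-cross
    where
    open Wedge (dipole 1 3) (dipole 2 3)
    1≤1 : 1 ≤ 1
    1≤1 = s≤s z≤n
    1≤2 : 1 ≤ 2
    1≤2 = s≤s z≤n
    1≤3 : 1 ≤ 3
    1≤3 = s≤s z≤n
    2≤3 : 2 ≤ 3
    2≤3 = s≤s (s≤s z≤n)
    2≤c : 2 ≤ c
    2≤c = ℕ.≤-trans 2≤3 3≤c
    3≤n : 3 ≤ n
    3≤n = ℕ.≤-trans 3≤c c≤n
    on-cross : ∀ {a x} → 1 ≤ a → a ≤ c → c < x → x ≤ n → C * wedge (a , x) ≈ N * wedge (a , x)
    on-cross {a} {x} _ _ c<x _ =
      w≈0⇒x*w≈y*w (wedge-vanishes {a} {x} (dipole-off 1 3 (x≢ 1≤3) (x≢ ℕ.≤-refl)) (dipole-off 2 3 (x≢ 2≤3) (x≢ ℕ.≤-refl)))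
      where
      x≢ : ∀ {s} → s ≤ 3 → x ≢ s
      x≢ s≤3 = ℕ.>⇒≢ (ℕ.≤-<-trans (ℕ.≤-trans s≤3 3≤c) c<x)

  C-is-eigenvalue : 2 ≤ b → IsEigenvalue F n Ts C
  C-is-eigenvalue 2≤b =
    wedge , ((1 , suc c) , ∈-support⁺ 3≤c (cross 1≤1 1≤c (ℕ.n<1+n c) c+1≤n) ,
             wedge≉0 {1} {suc c} (dipole-at 1 2 (λ ())) (dipole-at (suc c) (suc (suc c)) (ℕ.<⇒≢ (ℕ.n<1+n (suc c))))
                     (dipole-off 1 2 {suc c} (ℕ.>⇒≢ 1<c+1) (ℕ.>⇒≢ 2<c+1)) (dipole-off (suc c) (suc (suc c)) {1} (ℕ.<⇒≢ 1<c+1) (λ ()))) ,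
    wedge-eigenvector C (∑-dipole n 1≤1 (ℕ.≤-trans 1≤c c≤n) 1≤2 (ℕ.≤-trans 2≤c c≤n))
                        (∑-dipole n (s≤s z≤n) c+1≤n (s≤s z≤n) c+2≤n)
                        (∑-dipole c 1≤1 1≤c 1≤2 2≤c)
                        (∑-dipole-out c (ℕ.n<1+n c) (ℕ.<-trans (ℕ.n<1+n c) (ℕ.n<1+n (suc c))))
                        on-clique (λ _ _ _ _ → refl)
    where
    open Wedge (dipole 1 2) (dipole (suc c) (suc (suc c)))
    1≤1 : 1 ≤ 1
    1≤1 = s≤s z≤n
    1≤2 : 1 ≤ 2
    1≤2 = s≤s z≤n
    2≤c : 2 ≤ c
    2≤c = ℕ.≤-trans (s≤s (s≤s z≤n)) 3≤c
    1≤c : 1 ≤ c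
    1≤c = ℕ.≤-trans 1≤2 2≤c
    1<c+1 : 1 < suc c
    1<c+1 = s≤s 1≤c
    2<c+1 : 2 < suc c
    2<c+1 = s≤s 2≤c
    c+2≤n : suc (suc c) ≤ n
    c+2≤n = ≡.subst (_≤ n) (ℕ.+-comm c 2) (ℕ.+-monoʳ-≤ c 2≤b)
    c+1≤n : suc c ≤ n
    c+1≤n = ℕ.≤-trans (ℕ.n≤1+n (suc c)) c+2≤n
    on-clique : ∀ {a d} → 1 ≤ a → a < d → d ≤ c → N * wedge (a , d) ≈ C * wedge (a , d)
    on-clique {a} {d} _ a<d d≤c =
      w≈0⇒x*w≈y*w (wedge-vanishes-Q {a} {d} (clique-Q≈0 (ℕ.<⇒≤ (ℕ.<-≤-trans a<d d≤c))) (clique-Q≈0 d≤c))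
      where
      clique-Q≈0 : ∀ {i} → i ≤ c → dipole (suc c) (suc (suc c)) i ≈ 0#
      clique-Q≈0 i≤c = dipole-off (suc c) (suc (suc c)) (ℕ.<⇒≢ (s≤s i≤c)) (ℕ.<⇒≢ (ℕ.m≤n⇒m≤1+n (s≤s i≤c)))

open import Data.Nat using (suc; _+_; z≤n; s≤s)
open import Data.Nat.Properties as ℕ using ()
open import Data.Product using (_×_; _,_)
open import Function using (_∘_)
open import Relation.Binary.PropositionalEquality as ≡ using (_≡_)
open import Relation.Binary.Structures using (IsStrictTotalOrder)

corollary3p20 : ∀ {k ℓ} (F : OrderedField k ℓ) (c b : ℕ) → 3 ≤ c → 1 ≤ b →
    (b ≡ 1 → IsSmallestPosEigenvalue F (c + b) (triangles c b) (fromℕ F (suc c))) ×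
    (2 ≤ b → IsSmallestPosEigenvalue F (c + b) (triangles c b) (fromℕ F c))
corollary3p20 F c b 3≤c 1≤b = gap-b≡1 , gap-b≥2
  where
  open OrderedField F using (_<_; sym; isSTO)
  open IsStrictTotalOrder isSTO using () renaming (trans to <-trans)
  open OrderedFieldProperties F
  open Spectrum F c b 3≤c

  C<N : C < N
  C<N = fromℕ-mono-< (ℕ.m<m+n c 1≤b)

  gap-b≡1 : b ≡ 1 → IsSmallestPosEigenvalue F (c + b) (triangles c b) (fromℕ F (suc c))
  gap-b≡1 ≡.refl = ≡.subst (IsSmallestPosEigenvalue F (c + 1) (triangles c 1)) (≡.cong (fromℕ F) (ℕ.+-comm c 1))
    (fromℕ-mono-< (ℕ.<-≤-trans 1≤b (ℕ.m≤n+m 1 c)) , N-is-eigenvalue ,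
     λ μ 0<μ μ-eigen μ<N → no-eigenvalue-b≡1 ≡.refl μ (<⇒≉ 0<μ ∘ sym) (<⇒≉ μ<N) μ-eigen)

  gap-b≥2 : 2 ≤ b → IsSmallestPosEigenvalue F (c + b) (triangles c b) (fromℕ F c)
  gap-b≥2 2≤b =
    fromℕ-mono-< (ℕ.<-≤-trans (s≤s z≤n) 3≤c) , C-is-eigenvalue 2≤b ,
    λ μ 0<μ μ-eigen μ<C → no-eigenvalue μ (<⇒≉ 0<μ ∘ sym) (<⇒≉ (<-trans μ<C C<N)) (<⇒≉ μ<C) μ-eigen
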